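{- Let $\lambda$ be a restricted partition with $n$ parts (all parts distinct, exactly one part equal to $0$, no part equal to $1$). Let $\rho,\nu\in S_n(\lambda)$ and let $j$ be the index with $\rho_j=0$. Then $$\mathbb P^{(2)}_j(\rho,\nu)=\frac{c^\rho_\nu}{\prod_{k<j}\left(x_k-\frac{1}{t^{n-2}}\right)\prod_{k>j}\left(x_k-\frac{1}{t^{n-1}}\right)},$$ or equivalently $P_j\cdot\mathbb P^{(2)}_j(\rho,\nu)=c^\rho_\nu/e^*_{n-1}(\boldsymbol{x};t)$, where $e^*_{n-1}(\boldsymbol{x};t)=\sum_{i=1}^n\prod_{k<i}(x_k-t^{ -n+2})\prod_{k>i}(x_k-t^{ -n+1})$ and $P_j=\prod_{k<j}(x_k-t^{ -n+2})\prod_{k>j}(x_k-t^{ -n+1})/e^*_{n-1}(\boldsymbol{x};t)$.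
   Context: $S_n(\lambda)$ is the set of rearrangements of $\lambda$ in $\mathbb N^n$. Step 2 of the interpolation $t$-Push TASEP: configurations are labels on a ring of sites $1,\dots,n$, label $0$ being a vacancy. Set $\mathfrak p_k=\frac{t^{ -n+1}(1-t)}{x_k-t^{ -n+2}}$ and $\mathfrak q_k=\frac{(1-t)x_k}{x_k-t^{ -n+2}}$. Starting from $\rho$ with $\rho_j=0$, the vacancy at site $j$ is regarded as an active particle of label $a=0$; it starts at site $1$ and travels through sites $k=1,\dots,j-1$ in order. At a site $k$ holding label $b\ge0$, it settles there with probability $\mathfrak p_k$ if $b\ge a$ and $\mathfrak q_k$ if $b<a$, in which case the particle $b$ is displaced, becomes active (now $a:=b$) and continues from site $k+1$; otherwise (probability $1-\mathfrak p_k$ resp. $1-\mathfrak q_k$) it skips site $k$. Upon reaching site $j$ the active particle settles there. $\mathbb P^{(2)}_j(\rho,\nu)$ is the probability that the resulting configuration is $\nu$. Signed two-line queue with top row $\alpha\in\mathbb Z^n$ and bottom row $\mu\in\mathbb N^n$: top row column $k$ holds a ball labelled $\alpha_k$ if $\alpha_k\ne0$, bottom row column $k$ a ball labelled $\mu_k$ if $\mu_k>0$; each top ball is matched to a distinct bottom ball such that: (i) top column $j$ matches bottom column $k\ge j$; (ii) matched labels have equal absolute value; (iii) a positive top ball $a$ has a ball $a'\ge a$ directly below it, matched to it if $a'=a$; (iv) a negative top ball $-a$ has below it an empty position or a ball $a'\le a$. Pairings with $j=k$ are trivial. Process top balls in decreasing absolute value, ties right to left; bottom balls not yet matched are free; for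 nontrivial $p$ from column $j$ to $k>j$, $\mathrm{skipped}(p)$ = free bottom balls in columns $j+1,\dots,k-1$, $\mathrm{emp}(p)$ = empty bottom positions there, $\mathrm{wt}(p)=\pm(1-t)t^{\mathrm{skipped}(p)+\mathrm{emp}(p)}$ (sign of the top ball). $b^\alpha_\mu=\sum_Q\prod_{p\text{ nontrivial}}\mathrm{wt}(p)$ over signed two-line queues $Q$ with rows $\alpha,\mu$; $\mathrm{wt}_\alpha=\prod_{k:\alpha_k>0}x_k\prod_{k:\alpha_k<0}(-t^{ -(n-1)})$; $c^\kappa_\nu=\sum_{\alpha\in\mathbb Z^n:(|\alpha_i|)_i=\kappa}\mathrm{wt}_\alpha b^\alpha_\nu$. -}

module Defs where

open import Level using (Level; _⊔_) renaming (suc to lsuc)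
open import Data.Bool using (Bool; true; false; if_then_else_; _∧_; _∨_; not)
open import Data.Nat as ℕ using (ℕ; zero; suc)
import Data.Nat.Properties as ℕP
open import Data.Integer as ℤ using (ℤ; +_; +[1+_]; -[1+_]; ∣_∣)
open import Data.Fin as Fin using (Fin)
import Data.Fin.Properties as FinP
open import Data.Fin.Permutation using (Permutation′; _⟨$⟩ʳ_)
open import Data.List using (List; []; _∷_; foldr; map; concatMap; filterᵇ; length)
open import Data.List.Base using (allFin)
open import Data.Maybe using (Maybe; just; nothing)
open import Data.Product using (Σ; _×_; _,_)
open import Data.Vec.Functional as VF using ()
open import Relation.Nullary using (¬_)
open import Relation.Nullary.Decidable using (⌊_⌋)
open import Relation.Binary.PropositionalEquality using (_≡_; _≢_)
open import Algebra.Bundles using (CommutativeRing)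

record Field (c ℓ : Level) : Set (lsuc (c ⊔ ℓ)) where
  field
    commutativeRing : CommutativeRing c ℓ
  open CommutativeRing commutativeRing public
  field
    _⁻¹        : Carrier → Carrier
    ⁻¹-inverse : ∀ x → ¬ (x ≈ 0#) → (x * (x ⁻¹)) ≈ 1#
    0≉1        : ¬ (0# ≈ 1#)

IsRestrictedPartition : (n : ℕ) → (Fin n → ℕ) → Set
IsRestrictedPartition n lam =
    (∀ i k → i Fin.< k → lam k ℕ.≤ lam i)
  × (∀ i k → lam i ≡ lam k → i ≡ k)
  × Σ (Fin n) (λ i → lam i ≡ 0 × (∀ k → lam k ≡ 0 → k ≡ i))
  × (∀ i → lam i ≢ 1)

InS : (n : ℕ) → (Fin n → ℕ) → (Fin n → ℕ) → Set
InS n lam rho = Σ (Permutation′ n) (λ σ → ∀ i → rho i ≡ lam (σ ⟨$⟩ʳ i))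

upd : ∀ {n} → (Fin n → ℕ) → Fin n → ℕ → (Fin n → ℕ)
upd c k a i = if ⌊ i FinP.≟ k ⌋ then a else c i

eqConf : ∀ {n} → (Fin n → ℕ) → (Fin n → ℕ) → Bool
eqConf c d = ⌊ FinP.all? (λ i → c i ℕ.≟ d i) ⌋

countᵇ : ∀ {n} → (Fin n → Bool) → ℕ
countᵇ {n} P = length (filterᵇ P (allFin n))

allFuns : ∀ {a} {A : Set a} (m : ℕ) → List A → List (Fin m → A)
allFuns zero    xs = (λ ()) ∷ []
allFuns (suc m) xs = concatMap (λ x → map (λ f → x VF.∷ f) (allFuns m xs)) xs

signings : ∀ {n} → (Fin n → ℕ) → List (Fin n → ℤ)
signings {zero}  κ = (λ ()) ∷ []
signings {suc n} κ =
  concatMap (λ s → map (λ f → s VF.∷ f) (signings (λ i → κ (Fin.suc i))))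
            (choices (κ Fin.zero))
  where
  choices : ℕ → List ℤ
  choices zero    = + 0 ∷ []
  choices (suc a) = + (suc a) ∷ -[1+ a ] ∷ []

isPos isNeg isZero : ℤ → Bool
isPos +[1+ _ ] = true
isPos _        = false
isNeg -[1+ _ ] = true
isNeg _        = false
isZero (+ zero) = true
isZero _        = false

_==ᶠ_ : ∀ {n} → Fin n → Fin n → Bool
i ==ᶠ k = ⌊ i FinP.≟ k ⌋

_<ᶠ_ : ∀ {n} → Fin n → Fin n → Bool
i <ᶠ k = ⌊ i FinP.<? k ⌋

_≤ᵇ_ _==ᵇ_ : ℕ → ℕ → Bool
a ≤ᵇ b = ⌊ a ℕ.≤? b ⌋
a ==ᵇ b = ⌊ a ℕ.≟ b ⌋

isJust : ∀ {n} → Maybe (Fin n) → Fin n → Bool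
isJust (just k) c = k ==ᶠ c
isJust nothing  c = false

allᶠ anyᶠ : ∀ {n} → (Fin n → Bool) → Bool
allᶠ {n} P = foldr _∧_ true  (map P (allFin n))
anyᶠ {n} P = foldr _∨_ false (map P (allFin n))

-- A pairing of a top row α and bottom row μ is encoded as
-- m : Fin n → Maybe (Fin n): m j = just k means the top ball at column j
-- is matched to the bottom ball at column k; m j = nothing iff column j
-- of the top row is empty (α_j = 0).

colOK : ∀ {n} → (Fin n → ℤ) → (Fin n → ℕ) → (Fin n → Maybe (Fin n)) → Fin n → Bool
colOK α μ m j with m j
... | nothing = isZero (α j)
... | just k  =
        not (isZero (α j))
      ∧ ⌊ Fin.toℕ j ℕ.≤? Fin.toℕ k ⌋
      ∧ not (μ k ==ᵇ 0)
      ∧ (∣ α j ∣ ==ᵇ μ k)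
      ∧ (if isPos (α j)
           then (not (μ j ==ᵇ 0) ∧ (∣ α j ∣ ≤ᵇ μ j)
                 ∧ (if μ j ==ᵇ ∣ α j ∣ then k ==ᶠ j else true))
           else ((μ j ==ᵇ 0) ∨ (μ j ≤ᵇ ∣ α j ∣)))

injOK : ∀ {n} → (Fin n → Maybe (Fin n)) → Bool
injOK m = allᶠ (λ j → allᶠ (λ j' → allᶠ (λ k →
            if isJust (m j) k ∧ isJust (m j') k then j ==ᶠ j' else true)))

IsSTLQ : ∀ {n} → (Fin n → ℤ) → (Fin n → ℕ) → (Fin n → Maybe (Fin n)) → Bool
IsSTLQ α μ m = allᶠ (colOK α μ m) ∧ injOK m

-- top ball at column j' is processed strictly before the one at column j
-- (decreasing absolute value, ties right to left)
before : ∀ {n} → (Fin n → ℤ) → Fin n → Fin n → Bool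
before α j' j = (∣ α j ∣ ℕ.<ᵇ ∣ α j' ∣) ∨ ((∣ α j' ∣ ==ᵇ ∣ α j ∣) ∧ (j <ᶠ j'))

between : ∀ {n} → Fin n → Fin n → Fin n → Bool
between j k c = (j <ᶠ c) ∧ (c <ᶠ k)

skipped : ∀ {n} → (Fin n → ℤ) → (Fin n → ℕ) → (Fin n → Maybe (Fin n)) → Fin n → Fin n → ℕ
skipped α μ m j k = countᵇ (λ c → between j k c ∧ not (μ c ==ᵇ 0)
  ∧ not (anyᶠ (λ j' → before α j' j ∧ isJust (m j') c)))

emp : ∀ {n} → (Fin n → ℕ) → Fin n → Fin n → ℕ
emp μ j k = countᵇ (λ c → between j k c ∧ (μ c ==ᵇ 0))

module WithField {c ℓ} (F : Field c ℓ) where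
  open Field F public

  Σᴸ : ∀ {a} {A : Set a} → List A → (A → Carrier) → Carrier
  Σᴸ xs f = foldr (λ x r → f x + r) 0# xs

  Πᴸ : ∀ {a} {A : Set a} → List A → (A → Carrier) → Carrier
  Πᴸ xs f = foldr (λ x r → f x * r) 1# xs

  _^ᴺ_ : Carrier → ℕ → Carrier
  x ^ᴺ zero  = 1#
  x ^ᴺ suc k = x * (x ^ᴺ k)

  _^ᶻ_ : Carrier → ℤ → Carrier
  x ^ᶻ (+ k)    = x ^ᴺ k
  x ^ᶻ -[1+ k ] = (x ⁻¹) ^ᴺ suc k

  module Params (n : ℕ) (x : Fin n → Carrier) (t : Carrier) where

    t₂ t₁ : Carrier
    t₂ = t ^ᶻ (+ 2 ℤ.- + n)
    t₁ = t ^ᶻ (+ 1 ℤ.- + n)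

    𝔭 𝔮 : Fin n → Carrier
    𝔭 k = (t₁ * (1# - t)) * ((x k - t₂) ⁻¹)
    𝔮 k = ((1# - t) * x k) * ((x k - t₂) ⁻¹)

    -- Step 2 of the interpolation t-Push TASEP.
    -- run ν j ks conf a : probability of ending in ν, when the active
    -- particle of label a still has to visit sites ks (in order) and then
    -- settles at site j.
    run : (Fin n → ℕ) → Fin n → List (Fin n) → (Fin n → ℕ) → ℕ → Carrier
    run ν j [] conf a = if eqConf (upd conf j a) ν then 1# else 0#
    run ν j (k ∷ ks) conf a =
        (s * run ν j ks (upd conf k a) b) + ((1# - s) * run ν j ks conf a)
      where
      b = conf k
      s = if a ≤ᵇ b then 𝔭 k else 𝔮 k

    -- ℙ^{(2)}_j(ρ, ν): the active vacancy (label 0) travels sites 1,…,j-1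
    P2 : Fin n → (Fin n → ℕ) → (Fin n → ℕ) → Carrier
    P2 j ρ ν = run ν j (filterᵇ (λ k → k <ᶠ j) (allFin n)) ρ 0

    pairWt : (Fin n → ℤ) → (Fin n → ℕ) → (Fin n → Maybe (Fin n)) → Fin n → Carrier
    pairWt α μ m j with m j
    ... | nothing = 1#
    ... | just k  =
      if j <ᶠ k
        then (if isPos (α j) then w else - w)
        else 1#
      where w = (1# - t) * (t ^ᴺ (skipped α μ m j k ℕ.+ emp μ j k))

    wtQ : (Fin n → ℤ) → (Fin n → ℕ) → (Fin n → Maybe (Fin n)) → Carrier
    wtQ α μ m = Πᴸ (allFin n) (pairWt α μ m)

    bCoef : (Fin n → ℤ) → (Fin n → ℕ) → Carrier
    bCoef α μ = Σᴸ (allFuns n (nothing ∷ map just (allFin n)))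
                   (λ m → if IsSTLQ α μ m then wtQ α μ m else 0#)

    wtα : (Fin n → ℤ) → Carrier
    wtα α = Πᴸ (allFin n) (λ k →
      if isPos (α k) then x k else (if isNeg (α k) then - t₁ else 1#))

    cCoef : (Fin n → ℕ) → (Fin n → ℕ) → Carrier
    cCoef κ ν = Σᴸ (signings κ) (λ α → wtα α * bCoef α ν)

    denom : Fin n → Carrier
    denom j = Πᴸ (allFin n) (λ k →
      if k <ᶠ j then x k - t₂ else (if j <ᶠ k then x k - t₁ else 1#))

{-# OPTIONS --safe #-}

-- Because the parts of λ are distinct, both sides are forced to be products
-- over the sites.  In a signed two-line queue with rows α (|α| = ρ) and ν, the
-- top ball of column i can only be matched to the column dest i where ν carries
-- the label ρ_i, so b^α_ν, and then c^ρ_ν, factor over the columns.  The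
-- power of t of the pairing leaving column i counts the columns it passes over
-- whose label is smaller than ρ_i, so it can be charged to those columns, which
-- makes c^ρ_ν a product of site weights.  In the TASEP step the run is forced
-- too: at a site k < j the active particle must skip when ν_k = ρ_k and settle
-- when ν_k is its own label; in every other case the probability is 0, and so
-- is the weight of the site the label ν_k would have to come from.  Site by
-- site, the probability of the move taken at k times x_k − t^{2−n} is the
-- weight of site k, and the sites k ≥ j supply the remaining denominator
-- factors.

module Submission where

open import Defs
open import Algebra.Bundles using (CommutativeMonoid)
open import Data.Bool using (Bool; true; false; if_then_else_; _∧_; _∨_; not; T; T?)
import Data.Bool.Properties as Boolₚ
open import Data.Empty using (⊥-elim)
open import Data.Fin as Fin using (Fin; toℕ; _<_)
import Data.Fin.Properties as Finₚ
open import Data.Fin.Permutation using (_⟨$⟩ʳ_; _⟨$⟩ˡ_; inverseˡ; inverseʳ)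
open import Data.Integer as ℤ using (ℤ; +_; -[1+_]; ∣_∣)
import Data.List
open import Data.List using (List; []; _∷_; _++_; map; concatMap; filterᵇ; length; tabulate)
import Data.List.Properties as Listₚ
open import Data.List.Relation.Unary.All as All using (All)
import Data.List.Relation.Unary.All.Properties as Allₚ
open import Data.List.Base using (allFin)
open import Data.List.Membership.Propositional using (_∈_; find)
open import Data.List.Membership.Propositional.Properties using (∈-concatMap⁻; ∈-map⁻; ∈-allFin)
open import Data.List.Relation.Unary.Any using (here; there)
open import Data.Maybe using (Maybe; just; nothing)
open import Data.Nat as ℕ using (ℕ; zero; suc)
import Data.Nat.Properties as ℕₚ
open import Data.Product using (∃-syntax; _×_; _,_; proj₁; proj₂)
import Data.Sum as Sum
open import Data.Sum using (_⊎_; inj₁; inj₂; [_,_]′)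
open import Data.Unit using (tt)
import Data.Vec.Functional as VF
open import Function using (_∘_)
open import Function.Bundles using (Equivalence)
open import Relation.Binary.PropositionalEquality as ≡ using (_≡_; _≢_; refl; module ≡-Reasoning)
open import Relation.Nullary using (¬_; Dec; yes; no)
open import Relation.Binary.Definitions using (Tri; tri<; tri≈; tri>)
open import Relation.Nullary.Decidable using (⌊_⌋; isYes≗does; dec-true; dec-false; toWitness)

module _ {p} {A : Set p} (a? : Dec A) where

  ⌊⌋-true : A → ⌊ a? ⌋ ≡ true
  ⌊⌋-true a = ≡.trans (isYes≗does a?) (dec-true a? a)

  ⌊⌋-false : ¬ A → ⌊ a? ⌋ ≡ false
  ⌊⌋-false ¬a = ≡.trans (isYes≗does a?) (dec-false a? ¬a)

  ⌊⌋-true⁻ : ⌊ a? ⌋ ≡ true → A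
  ⌊⌋-true⁻ e = toWitness (≡.subst T (≡.sym e) tt)

  ⌊⌋-false⁻ : ⌊ a? ⌋ ≡ false → ¬ A
  ⌊⌋-false⁻ e a with () ← ≡.trans (≡.sym (⌊⌋-true a)) e

<ᵇ-true : ∀ {m n} → m ℕ.< n → (m ℕ.<ᵇ n) ≡ true
<ᵇ-true m<n = Equivalence.to Boolₚ.T-≡ (ℕₚ.<⇒<ᵇ m<n)

<ᵇ-false : ∀ {m n} → ¬ m ℕ.< n → (m ℕ.<ᵇ n) ≡ false
<ᵇ-false m≮n = Boolₚ.¬-not (m≮n ∘ ℕₚ.<ᵇ⇒< _ _ ∘ Equivalence.from Boolₚ.T-≡)

module _ {m n : ℕ} where

  ==ᵇ-true : m ≡ n → (m ==ᵇ n) ≡ true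
  ==ᵇ-true = ⌊⌋-true (m ℕ.≟ n)

  ==ᵇ-false : m ≢ n → (m ==ᵇ n) ≡ false
  ==ᵇ-false = ⌊⌋-false (m ℕ.≟ n)

  ==ᵇ-true⁻ : (m ==ᵇ n) ≡ true → m ≡ n
  ==ᵇ-true⁻ = ⌊⌋-true⁻ (m ℕ.≟ n)

  ==ᵇ-false⁻ : (m ==ᵇ n) ≡ false → m ≢ n
  ==ᵇ-false⁻ = ⌊⌋-false⁻ (m ℕ.≟ n)

  ≤ᵇ-true : m ℕ.≤ n → (m ≤ᵇ n) ≡ true
  ≤ᵇ-true = ⌊⌋-true (m ℕ.≤? n)

  ≤ᵇ-false : ¬ m ℕ.≤ n → (m ≤ᵇ n) ≡ false
  ≤ᵇ-false = ⌊⌋-false (m ℕ.≤? n)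

  ≤ᵇ-true⁻ : (m ≤ᵇ n) ≡ true → m ℕ.≤ n
  ≤ᵇ-true⁻ = ⌊⌋-true⁻ (m ℕ.≤? n)

  not-<ᵇ : m ≢ n → not (n ℕ.<ᵇ m) ≡ (m ℕ.<ᵇ n)
  not-<ᵇ m≢n with ℕₚ.<-cmp m n
  ... | tri< m<n _ _ = ≡.trans (≡.cong not (<ᵇ-false (ℕₚ.<⇒≯ m<n))) (≡.sym (<ᵇ-true m<n))
  ... | tri≈ _ m≡n _ = ⊥-elim (m≢n m≡n)
  ... | tri> _ _ n<m = ≡.trans (≡.cong not (<ᵇ-true n<m)) (≡.sym (<ᵇ-false (ℕₚ.<⇒≯ n<m)))

module _ {n} {i k : Fin n} where

  ==ᶠ-true : i ≡ k → (i ==ᶠ k) ≡ true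
  ==ᶠ-true = ⌊⌋-true (i Finₚ.≟ k)

  ==ᶠ-false : i ≢ k → (i ==ᶠ k) ≡ false
  ==ᶠ-false = ⌊⌋-false (i Finₚ.≟ k)

  <ᶠ-true : i < k → (i <ᶠ k) ≡ true
  <ᶠ-true = ⌊⌋-true (i Finₚ.<? k)

  <ᶠ-false : ¬ i < k → (i <ᶠ k) ≡ false
  <ᶠ-false = ⌊⌋-false (i Finₚ.<? k)

  <ᶠ-true⁻ : (i <ᶠ k) ≡ true → i < k
  <ᶠ-true⁻ = ⌊⌋-true⁻ (i Finₚ.<? k)

isZero-true⁻ : ∀ s → isZero s ≡ true → ∣ s ∣ ≡ 0
isZero-true⁻ (+ zero) _ = refl

isZero-false⁻ : ∀ s → isZero s ≡ false → ∣ s ∣ ≢ 0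
isZero-false⁻ (+ suc _) _ ()
isZero-false⁻ -[1+ _ ]  _ ()

∧-true⁻ : ∀ {u v} → u ∧ v ≡ true → u ≡ true × v ≡ true
∧-true⁻ {true} {true} _ = refl , refl

isJust-true⁻ : ∀ {n} (v : Maybe (Fin n)) {k} → isJust v k ≡ true → v ≡ just k
isJust-true⁻ (just k′) {k} e = ≡.cong just (⌊⌋-true⁻ (k′ Finₚ.≟ k) e)

upd-same : ∀ {n} (cf : Fin n → ℕ) k a → upd cf k a k ≡ a
upd-same cf k a = Boolₚ.if-cong (⌊⌋-true (k Finₚ.≟ k) refl)

upd-other : ∀ {n} (cf : Fin n → ℕ) k a {i} → i ≢ k → upd cf k a i ≡ cf i
upd-other cf k a {i} i≢k = Boolₚ.if-cong (⌊⌋-false (i Finₚ.≟ k) i≢k)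

signs : ℕ → List ℤ
signs zero    = + 0 ∷ []
signs (suc a) = + suc a ∷ -[1+ a ] ∷ []

∈-signs⁻ : ∀ {s a} → s ∈ signs a → ∣ s ∣ ≡ a
∈-signs⁻ {a = zero}  (here refl)         = refl
∈-signs⁻ {a = suc a} (here refl)         = refl
∈-signs⁻ {a = suc a} (there (here refl)) = refl

module _ {a} {A : Set a} where

  cartesian : ∀ {m} → (Fin m → List A) → List (Fin m → A)
  cartesian {zero}  L = (λ ()) ∷ []
  cartesian {suc m} L = concatMap (λ u → map (u VF.∷_) (cartesian (L ∘ Fin.suc))) (L Fin.zero)

  ∈-cartesian⁻ : ∀ {m} (L : Fin m → List A) {φ} → φ ∈ cartesian L → ∀ i → φ i ∈ L i
  ∈-cartesian⁻ {suc m} L φ∈ i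
    with u , u∈ , φ∈′ ← find (∈-concatMap⁻ _ {xs = L Fin.zero} φ∈)
    with f , f∈ , refl ← ∈-map⁻ (u VF.∷_) φ∈′
    with i
  ... | Fin.zero  = u∈
  ... | Fin.suc i = ∈-cartesian⁻ (L ∘ Fin.suc) f∈ i

  allFuns≡cartesian : ∀ m (xs : List A) → allFuns m xs ≡ cartesian (λ _ → xs)
  allFuns≡cartesian zero    xs = refl
  allFuns≡cartesian (suc m) xs =
    ≡.cong (λ fs → concatMap (λ u → map (u VF.∷_) fs) xs) (allFuns≡cartesian m xs)

signings≡cartesian : ∀ {n} (κ : Fin n → ℕ) → signings κ ≡ cartesian (signs ∘ κ)
signings≡cartesian {zero}  κ = refl
signings≡cartesian {suc n} κ
  rewrite signings≡cartesian (κ ∘ Fin.suc) with κ Fin.zero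
... | zero  = refl
... | suc a = refl

interval : ℕ → ℕ → List ℕ
interval c zero    = []
interval c (suc d) = c ∷ interval (suc c) d

map-suc-interval : ∀ c d → map suc (interval c d) ≡ interval (suc c) d
map-suc-interval c zero    = refl
map-suc-interval c (suc d) = ≡.cong (suc c ∷_) (map-suc-interval (suc c) d)

interval-avoids : ∀ {n} {ks : List (Fin n)} {c₀ d c} → map toℕ ks ≡ interval c₀ d → toℕ c ℕ.< c₀ → All (_≢ c) ks
interval-avoids {ks = []}     {d = zero}  _  _    = All.[]
interval-avoids {ks = k ∷ ks} {d = suc d} eq c<c₀ =
  (λ k≡c → ℕₚ.<-irrefl (≡.trans (≡.cong toℕ (≡.sym k≡c)) (Listₚ.∷-injectiveˡ eq)) c<c₀)
  All.∷ interval-avoids (Listₚ.∷-injectiveʳ eq) (ℕₚ.m<n⇒m<1+n c<c₀)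

filterᵇ-map : ∀ {a b} {A : Set a} {B : Set b} {P : B → Bool} {Q : A → Bool} (f : A → B) →
              (∀ x → P (f x) ≡ Q x) → ∀ xs → filterᵇ P (map f xs) ≡ map f (filterᵇ Q xs)
filterᵇ-map f P∘f≗Q []       = refl
filterᵇ-map {P = P} {Q} f P∘f≗Q (x ∷ xs) with P (f x) | Q x | P∘f≗Q x
... | true  | true  | refl = ≡.cong (f x ∷_) (filterᵇ-map f P∘f≗Q xs)
... | false | false | refl = filterᵇ-map f P∘f≗Q xs

<ᶠ-suc : ∀ {n} (k j : Fin n) → (Fin.suc k <ᶠ Fin.suc j) ≡ (k <ᶠ j)
<ᶠ-suc k j with k Finₚ.<? j
... | yes k<j = ⌊⌋-true (Fin.suc k Finₚ.<? Fin.suc j) (ℕ.s<s k<j)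
... | no  k≮j = ⌊⌋-false (Fin.suc k Finₚ.<? Fin.suc j) (k≮j ∘ ℕₚ.≤-pred)

toℕ-sitesBefore : ∀ {n} (j : Fin n) → map toℕ (filterᵇ (_<ᶠ j) (allFin n)) ≡ interval 0 (toℕ j)
toℕ-sitesBefore {suc n} Fin.zero =
  ≡.cong (map toℕ) (Listₚ.filter-none (T? ∘ (_<ᶠ Fin.zero)) (All.universal (λ _ ()) (allFin (suc n))))
toℕ-sitesBefore {suc n} (Fin.suc j) = ≡.cong (0 ∷_) (begin
  map toℕ (filterᵇ (_<ᶠ Fin.suc j) (tabulate Fin.suc))
    ≡⟨ ≡.cong (map toℕ ∘ filterᵇ (_<ᶠ Fin.suc j)) (≡.sym (Listₚ.map-tabulate (λ i → i) Fin.suc)) ⟩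
  map toℕ (filterᵇ (_<ᶠ Fin.suc j) (map Fin.suc (allFin n)))
    ≡⟨ ≡.cong (map toℕ) (filterᵇ-map Fin.suc (λ k → <ᶠ-suc k j) (allFin n)) ⟩
  map toℕ (map Fin.suc (filterᵇ (_<ᶠ j) (allFin n)))
    ≡⟨ ≡.sym (Listₚ.map-∘ (filterᵇ (_<ᶠ j) (allFin n))) ⟩
  map (suc ∘ toℕ) (filterᵇ (_<ᶠ j) (allFin n))
    ≡⟨ Listₚ.map-∘ (filterᵇ (_<ᶠ j) (allFin n)) ⟩
  map suc (map toℕ (filterᵇ (_<ᶠ j) (allFin n)))
    ≡⟨ ≡.cong (map suc) (toℕ-sitesBefore j) ⟩
  map suc (interval 0 (toℕ j))
    ≡⟨ map-suc-interval 0 (toℕ j) ⟩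
  interval 1 (toℕ j) ∎)
  where open ≡-Reasoning

module Fold {c ℓ} (M : CommutativeMonoid c ℓ) where
  open CommutativeMonoid M renaming (refl to ≈-refl)
  open import Algebra.Properties.CommutativeSemigroup commutativeSemigroup using (interchange)
  open import Relation.Binary.Reasoning.Setoid setoid

  fold : ∀ {a} {A : Set a} → List A → (A → Carrier) → Carrier
  fold xs f = Data.List.foldr (λ x r → f x ∙ r) ε xs

  module _ {a} {A : Set a} where

    fold-cong-∈ : ∀ (xs : List A) {f g} → (∀ {x} → x ∈ xs → f x ≈ g x) → fold xs f ≈ fold xs g
    fold-cong-∈ []       f≈g = ≈-refl
    fold-cong-∈ (x ∷ xs) f≈g = ∙-cong (f≈g (here refl)) (fold-cong-∈ xs (f≈g ∘ there))

    fold-cong : ∀ (xs : List A) {f g} → (∀ x → f x ≈ g x) → fold xs f ≈ fold xs g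
    fold-cong xs f≈g = fold-cong-∈ xs (λ {x} _ → f≈g x)

    fold-ε : ∀ (xs : List A) → fold xs (λ _ → ε) ≈ ε
    fold-ε []       = ≈-refl
    fold-ε (x ∷ xs) = trans (identityˡ _) (fold-ε xs)

    fold-∙ : ∀ (xs : List A) f g → fold xs (λ x → f x ∙ g x) ≈ fold xs f ∙ fold xs g
    fold-∙ []       f g = sym (identityˡ ε)
    fold-∙ (x ∷ xs) f g = trans (∙-congˡ (fold-∙ xs f g)) (interchange _ _ _ _)

    fold-++ : ∀ (xs ys : List A) f → fold (xs ++ ys) f ≈ fold xs f ∙ fold ys f
    fold-++ []       ys f = sym (identityˡ _)
    fold-++ (x ∷ xs) ys f = trans (∙-congˡ (fold-++ xs ys f)) (sym (assoc _ _ _))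

  module _ {a b} {A : Set a} {B : Set b} where

    fold-map : ∀ (g : A → B) xs f → fold (map g xs) f ≡ fold xs (f ∘ g)
    fold-map g []       f = refl
    fold-map g (x ∷ xs) f = ≡.cong (f (g x) ∙_) (fold-map g xs f)

    fold-swap : ∀ (xs : List A) (ys : List B) (f : A → B → Carrier) →
                fold xs (λ x → fold ys (f x)) ≈ fold ys (λ y → fold xs (λ x → f x y))
    fold-swap []       ys f = sym (fold-ε ys)
    fold-swap (x ∷ xs) ys f =
      trans (∙-congˡ (fold-swap xs ys f)) (sym (fold-∙ ys (f x) (λ y → fold xs (λ x′ → f x′ y))))

  fold-allFin-suc : ∀ n (f : Fin (suc n) → Carrier) →
                    fold (allFin (suc n)) f ≡ f Fin.zero ∙ fold (allFin n) (f ∘ Fin.suc)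
  fold-allFin-suc n f = ≡.cong (f Fin.zero ∙_) (≡.trans
    (≡.cong (λ l → fold l f) (≡.sym (Listₚ.map-tabulate (λ i → i) Fin.suc)))
    (fold-map Fin.suc (allFin n) f))

  fold-single : ∀ n (i₀ : Fin n) (f : Fin n → Carrier) → (∀ i → i ≢ i₀ → f i ≈ ε) →
                fold (allFin n) f ≈ f i₀
  fold-single (suc n) Fin.zero f f≈ε = begin
    fold (allFin (suc n)) f                     ≡⟨ fold-allFin-suc n f ⟩
    f Fin.zero ∙ fold (allFin n) (f ∘ Fin.suc)  ≈⟨ ∙-congˡ (fold-cong (allFin n) (λ i → f≈ε (Fin.suc i) λ ())) ⟩
    f Fin.zero ∙ fold (allFin n) (λ _ → ε)      ≈⟨ ∙-congˡ (fold-ε (allFin n)) ⟩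
    f Fin.zero ∙ ε                              ≈⟨ identityʳ _ ⟩
    f Fin.zero                                  ∎
  fold-single (suc n) (Fin.suc i₀) f f≈ε = begin
    fold (allFin (suc n)) f                     ≡⟨ fold-allFin-suc n f ⟩
    f Fin.zero ∙ fold (allFin n) (f ∘ Fin.suc)  ≈⟨ ∙-congʳ (f≈ε Fin.zero λ ()) ⟩
    ε ∙ fold (allFin n) (f ∘ Fin.suc)           ≈⟨ identityˡ _ ⟩
    fold (allFin n) (f ∘ Fin.suc)               ≈⟨ fold-single n i₀ (f ∘ Fin.suc) (λ i → f≈ε (Fin.suc i) ∘ (_∘ Finₚ.suc-injective)) ⟩
    f (Fin.suc i₀)                              ∎

module _ {n} (P : Fin n → Bool) where

  allᶠ-true⁻ : allᶠ P ≡ true → ∀ i → P i ≡ true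
  allᶠ-true⁻ e i = Equivalence.to Boolₚ.T-≡
    (All.lookup (Allₚ.all⁺ P (allFin n) (Equivalence.from Boolₚ.T-≡ e)) (∈-allFin i))

  allᶠ-true : (∀ i → P i ≡ true) → allᶠ P ≡ true
  allᶠ-true h = Equivalence.to Boolₚ.T-≡
    (Allₚ.all⁻ P {xs = allFin n} (All.tabulate λ {i} _ → Equivalence.from Boolₚ.T-≡ (h i)))

  allᶠ-false⁻ : allᶠ P ≡ false → ∃[ i ] P i ≡ false
  allᶠ-false⁻ e with i , Pi≢true ← Finₚ.¬∀⟶∃¬ n (λ i → P i ≡ true) (λ i → P i Boolₚ.≟ true)
                                     (λ h → Boolₚ.not-¬ e (allᶠ-true h))
    = i , Boolₚ.¬-not Pi≢true

  anyᶠ-single : ∀ i₀ → (∀ i → i ≢ i₀ → P i ≡ false) → anyᶠ P ≡ P i₀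
  anyᶠ-single i₀ h = ≡.trans (foldr-map _∨_ false P (allFin n)) (Fold.fold-single Boolₚ.∨-commutativeMonoid n i₀ P h)
    where
    foldr-map : ∀ {A B : Set} (g : B → Bool → Bool) e (f : A → B) xs →
                Data.List.foldr g e (map f xs) ≡ Data.List.foldr (λ x → g (f x)) e xs
    foldr-map g e f []       = refl
    foldr-map g e f (x ∷ xs) = ≡.cong (g (f x)) (foldr-map g e f xs)

module BigOperators {c ℓ} (F : Field c ℓ) where
  open WithField F renaming (refl to ≈-refl)
  open import Relation.Binary.Reasoning.Setoid setoid

  open Fold +-commutativeMonoid public using () renaming
    ( fold-cong to Σᴸ-cong; fold-cong-∈ to Σᴸ-cong-∈; fold-ε to Σᴸ-0; fold-++ to Σᴸ-++
    ; fold-map to Σᴸ-map; fold-single to Σᴸ-single )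
  open Fold *-commutativeMonoid public using () renaming
    ( fold-cong to Πᴸ-cong; fold-ε to Πᴸ-1; fold-∙ to Πᴸ-*; fold-swap to Πᴸ-swap
    ; fold-allFin-suc to Πᴸ-allFin-suc; fold-single to Πᴸ-single )

  module _ {a} {A : Set a} where

    Σᴸ-*ˡ : ∀ (xs : List A) u f → u * Σᴸ xs f ≈ Σᴸ xs (λ x → u * f x)
    Σᴸ-*ˡ []       u f = zeroʳ u
    Σᴸ-*ˡ (x ∷ xs) u f = trans (distribˡ u _ _) (+-congˡ (Σᴸ-*ˡ xs u f))

    Σᴸ-*ʳ : ∀ (xs : List A) u f → Σᴸ xs f * u ≈ Σᴸ xs (λ x → f x * u)
    Σᴸ-*ʳ xs u f = trans (*-comm _ u) (trans (Σᴸ-*ˡ xs u f) (Σᴸ-cong xs (λ x → *-comm u (f x))))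

    Πᴸ-zero : ∀ {xs : List A} {x f} → x ∈ xs → f x ≈ 0# → Πᴸ xs f ≈ 0#
    Πᴸ-zero (here refl) fx≈0 = trans (*-congʳ fx≈0) (zeroˡ _)
    Πᴸ-zero (there x∈)  fx≈0 = trans (*-congˡ (Πᴸ-zero x∈ fx≈0)) (zeroʳ _)

    Πᴸ-if-count : ∀ (P : A → Bool) xs u → u ^ᴺ length (filterᵇ P xs) ≈ Πᴸ xs (λ x → if P x then u else 1#)
    Πᴸ-if-count P []       u = ≈-refl
    Πᴸ-if-count P (x ∷ xs) u with P x
    ... | true  = *-congˡ (Πᴸ-if-count P xs u)
    ... | false = trans (Πᴸ-if-count P xs u) (sym (*-identityˡ _))

  module _ {a b} {A : Set a} {B : Set b} where

    Σᴸ-concatMap : ∀ (g : A → List B) xs f → Σᴸ (concatMap g xs) f ≈ Σᴸ xs (λ x → Σᴸ (g x) f)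
    Σᴸ-concatMap g []       f = ≈-refl
    Σᴸ-concatMap g (x ∷ xs) f = trans (Σᴸ-++ (g x) (concatMap g xs) f) (+-congˡ (Σᴸ-concatMap g xs f))

  module _ {a} {A : Set a} where

    Σᴸ-cartesian : ∀ {m} (L : Fin m → List A) (g : Fin m → A → Carrier) →
                   Σᴸ (cartesian L) (λ φ → Πᴸ (allFin m) (λ i → g i (φ i))) ≈ Πᴸ (allFin m) (λ i → Σᴸ (L i) (g i))
    Σᴸ-cartesian {zero}  L g = +-identityʳ 1#
    Σᴸ-cartesian {suc m} L g = begin
      Σᴸ (concatMap (λ u → map (u VF.∷_) (cartesian L′)) (L Fin.zero)) G
        ≈⟨ Σᴸ-concatMap _ (L Fin.zero) G ⟩
      Σᴸ (L Fin.zero) (λ u → Σᴸ (map (u VF.∷_) (cartesian L′)) G)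
        ≈⟨ Σᴸ-cong (L Fin.zero) (λ u → trans (reflexive (Σᴸ-map (u VF.∷_) (cartesian L′) G))
                                               (Σᴸ-cong (cartesian L′) (λ φ → reflexive (Πᴸ-allFin-suc m _)))) ⟩
      Σᴸ (L Fin.zero) (λ u → Σᴸ (cartesian L′) (λ φ → g Fin.zero u * Πᴸ (allFin m) (λ i → g (Fin.suc i) (φ i))))
        ≈⟨ Σᴸ-cong (L Fin.zero) (λ u → sym (Σᴸ-*ˡ (cartesian L′) (g Fin.zero u) _)) ⟩
      Σᴸ (L Fin.zero) (λ u → g Fin.zero u * Σᴸ (cartesian L′) (λ φ → Πᴸ (allFin m) (λ i → g (Fin.suc i) (φ i))))
        ≈⟨ Σᴸ-cong (L Fin.zero) (λ u → *-congˡ (Σᴸ-cartesian L′ (g ∘ Fin.suc))) ⟩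
      Σᴸ (L Fin.zero) (λ u → g Fin.zero u * R)
        ≈⟨ sym (Σᴸ-*ʳ (L Fin.zero) R (g Fin.zero)) ⟩
      Σᴸ (L Fin.zero) (g Fin.zero) * R
        ≡⟨ ≡.sym (Πᴸ-allFin-suc m (λ i → Σᴸ (L i) (g i))) ⟩
      Πᴸ (allFin (suc m)) (λ i → Σᴸ (L i) (g i)) ∎
      where
      L′ = L ∘ Fin.suc
      G = λ (φ : Fin (suc m) → A) → Πᴸ (allFin (suc m)) (λ i → g i (φ i))
      R = Πᴸ (allFin m) (λ i → Σᴸ (L′ i) (g (Fin.suc i)))

module FieldFacts {c ℓ} (F : Field c ℓ) where
  open WithField F renaming (refl to ≈-refl)
  open BigOperators F
  open import Relation.Binary.Reasoning.Setoid setoid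
  open import Algebra.Properties.CommutativeSemigroup *-commutativeSemigroup using () renaming (interchange to *-interchange)
  open import Algebra.Properties.Ring ring
    using (x∙y⁻¹≈ε⇒x≈y; ⁻¹-anti-homo‿-; -‿involutive; -‿distribˡ-*; -‿distribʳ-*)

  if-≈ : ∀ b {u u′ v v′} → u ≈ u′ → v ≈ v′ → (if b then u else v) ≈ (if b then u′ else v′)
  if-≈ true  u≈u′ _ = u≈u′
  if-≈ false _ v≈v′ = v≈v′

  ⁻¹-inverseˡ : ∀ {u} → ¬ u ≈ 0# → u ⁻¹ * u ≈ 1#
  ⁻¹-inverseˡ u≉0 = trans (*-comm _ _) (⁻¹-inverse _ u≉0)

  *-nonzero : ∀ {u v} → ¬ u ≈ 0# → ¬ v ≈ 0# → ¬ u * v ≈ 0#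
  *-nonzero {u} {v} u≉0 v≉0 uv≈0 = v≉0 (begin
    v                ≈⟨ *-identityˡ v ⟨
    1# * v           ≈⟨ *-congʳ (⁻¹-inverseˡ u≉0) ⟨
    (u ⁻¹ * u) * v   ≈⟨ *-assoc _ _ _ ⟩
    u ⁻¹ * (u * v)   ≈⟨ *-congˡ uv≈0 ⟩
    u ⁻¹ * 0#        ≈⟨ zeroʳ _ ⟩
    0#               ∎)

  Πᴸ-nonzero : ∀ {a} {A : Set a} (xs : List A) {f : A → Carrier} → (∀ x → ¬ f x ≈ 0#) → ¬ Πᴸ xs f ≈ 0#
  Πᴸ-nonzero []       f≉0 1≈0 = 0≉1 (sym 1≈0)
  Πᴸ-nonzero (x ∷ xs) f≉0     = *-nonzero (f≉0 x) (Πᴸ-nonzero xs f≉0)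

  u≉v⇒u-v≉0 : ∀ {u v} → ¬ u ≈ v → ¬ u - v ≈ 0#
  u≉v⇒u-v≉0 u≉v u-v≈0 = u≉v (x∙y⁻¹≈ε⇒x≈y _ _ u-v≈0)

  *⁻¹-cancelʳ : ∀ {u d} → ¬ d ≈ 0# → (u * d ⁻¹) * d ≈ u
  *⁻¹-cancelʳ {u} {d} d≉0 = begin
    (u * d ⁻¹) * d  ≈⟨ *-assoc _ _ _ ⟩
    u * (d ⁻¹ * d)  ≈⟨ *-congˡ (⁻¹-inverseˡ d≉0) ⟩
    u * 1#          ≈⟨ *-identityʳ u ⟩
    u               ∎

  u*d≈v⇒u≈v*d⁻¹ : ∀ {u d v} → ¬ d ≈ 0# → u * d ≈ v → u ≈ v * d ⁻¹
  u*d≈v⇒u≈v*d⁻¹ {u} {d} {v} d≉0 ud≈v = begin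
    u                ≈⟨ *-identityʳ u ⟨
    u * 1#           ≈⟨ *-congˡ (⁻¹-inverse d d≉0) ⟨
    u * (d * d ⁻¹)   ≈⟨ *-assoc _ _ _ ⟨
    (u * d) * d ⁻¹   ≈⟨ *-congʳ ud≈v ⟩
    v * d ⁻¹         ∎

  [-u]*[-v]≈u*v : ∀ u v → (- u) * (- v) ≈ u * v
  [-u]*[-v]≈u*v u v = begin
    (- u) * (- v)  ≈⟨ -‿distribˡ-* u (- v) ⟨
    - (u * - v)    ≈⟨ -‿cong (-‿distribʳ-* u v) ⟨
    - (- (u * v))  ≈⟨ -‿involutive _ ⟩
    u * v          ∎

  [u-w]-[v-w] : ∀ u v w → (u - w) - (v - w) ≈ u - v
  [u-w]-[v-w] u v w = begin
    (u - w) - (v - w)    ≈⟨ +-congˡ (⁻¹-anti-homo‿- v w) ⟩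
    (u - w) + (w - v)    ≈⟨ +-assoc _ _ _ ⟩
    u + (- w + (w - v))  ≈⟨ +-congˡ (+-assoc _ _ _) ⟨
    u + ((- w + w) - v)  ≈⟨ +-congˡ (+-congʳ (-‿inverseˡ w)) ⟩
    u + (0# - v)         ≈⟨ +-congˡ (+-identityˡ _) ⟩
    u - v                ∎

  [u-v]-[u-w] : ∀ u v w → (u - v) - (u - w) ≈ w - v
  [u-v]-[u-w] u v w = begin
    (u - v) - (u - w)    ≈⟨ +-congˡ (⁻¹-anti-homo‿- u w) ⟩
    (u - v) + (w - u)    ≈⟨ +-comm _ _ ⟩
    (w - u) + (u - v)    ≈⟨ +-assoc _ _ _ ⟩
    w + (- u + (u - v))  ≈⟨ +-congˡ (+-assoc _ _ _) ⟨
    w + ((- u + u) - v)  ≈⟨ +-congˡ (+-congʳ (-‿inverseˡ u)) ⟩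
    w + (0# - v)         ≈⟨ +-congˡ (+-identityˡ _) ⟩
    w - v                ∎

  first-branch : ∀ {u v a b d e} → b ≈ 0# → (u * a + v * b) * (d * e) ≈ (u * d) * (a * e)
  first-branch {u} {v} {a} {b} {d} {e} b≈0 = begin
    (u * a + v * b) * (d * e)  ≈⟨ *-congʳ (trans (+-congˡ (trans (*-congˡ b≈0) (zeroʳ v))) (+-identityʳ _)) ⟩
    (u * a) * (d * e)          ≈⟨ *-interchange u a d e ⟩
    (u * d) * (a * e)          ∎

  second-branch : ∀ {u v a b d e} → a ≈ 0# → (u * a + v * b) * (d * e) ≈ (v * d) * (b * e)
  second-branch {u} {v} {a} {b} {d} {e} a≈0 = begin
    (u * a + v * b) * (d * e)  ≈⟨ *-congʳ (trans (+-congʳ (trans (*-congˡ a≈0) (zeroʳ u))) (+-identityˡ _)) ⟩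
    (v * b) * (d * e)          ≈⟨ *-interchange v b d e ⟩
    (v * d) * (b * e)          ∎

  ^ᴺ-+ : ∀ u m k → u ^ᴺ (m ℕ.+ k) ≈ u ^ᴺ m * u ^ᴺ k
  ^ᴺ-+ u zero    k = sym (*-identityˡ _)
  ^ᴺ-+ u (suc m) k = trans (*-congˡ (^ᴺ-+ u m k)) (sym (*-assoc _ _ _))

  t^[1-n]*t≈t^[2-n] : ∀ {t} → ¬ t ≈ 0# → ∀ {n} → Fin n →
                      (t ^ᶻ (+ 1 ℤ.- + n)) * t ≈ t ^ᶻ (+ 2 ℤ.- + n)
  t^[1-n]*t≈t^[2-n] {t} t≉0 {suc zero}          _ = *-comm 1# t
  t^[1-n]*t≈t^[2-n] {t} t≉0 {suc (suc zero)}    _ = trans (*-congʳ (*-identityʳ _)) (⁻¹-inverseˡ t≉0)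
  t^[1-n]*t≈t^[2-n] {t} t≉0 {suc (suc (suc m))} _ = begin
    (t ⁻¹ * (t ⁻¹) ^ᴺ suc m) * t  ≈⟨ *-comm _ t ⟩
    t * (t ⁻¹ * (t ⁻¹) ^ᴺ suc m)  ≈⟨ *-assoc _ _ _ ⟨
    (t * t ⁻¹) * (t ⁻¹) ^ᴺ suc m  ≈⟨ *-congʳ (⁻¹-inverse t t≉0) ⟩
    1# * (t ⁻¹) ^ᴺ suc m          ≈⟨ *-identityˡ _ ⟩
    (t ⁻¹) ^ᴺ suc m               ∎

-- Rearrangements with distinct labels

record DistinctRearrangement {n} (ρ ν : Fin n → ℕ) : Set where
  field
    ρ-injective : ∀ {i k} → ρ i ≡ ρ k → i ≡ k
    ν-injective : ∀ {i k} → ν i ≡ ν k → i ≡ k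
    dest        : Fin n → Fin n
    ν∘dest      : ∀ i → ν (dest i) ≡ ρ i
    origin      : Fin n → Fin n
    ρ∘origin    : ∀ k → ρ (origin k) ≡ ν k

  dest-unique : ∀ {i k} → ν k ≡ ρ i → k ≡ dest i
  dest-unique e = ν-injective (≡.trans e (≡.sym (ν∘dest _)))

  origin-unique : ∀ {i k} → ρ i ≡ ν k → i ≡ origin k
  origin-unique e = ρ-injective (≡.trans e (≡.sym (ρ∘origin _)))

  dest∘origin : ∀ k → dest (origin k) ≡ k
  dest∘origin k = ≡.sym (dest-unique (≡.sym (ρ∘origin k)))

module _ {n} {lam : Fin n → ℕ} (lam-injective : ∀ i k → lam i ≡ lam k → i ≡ k) where

  InS-injective : ∀ {ρ} → InS n lam ρ → ∀ {i k} → ρ i ≡ ρ k → i ≡ k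
  InS-injective (σ , ρ≡lam∘σ) {i} {k} ρi≡ρk = ≡.trans (≡.sym (inverseˡ σ)) (≡.trans
    (≡.cong (σ ⟨$⟩ˡ_) (lam-injective _ _ (≡.trans (≡.sym (ρ≡lam∘σ i)) (≡.trans ρi≡ρk (ρ≡lam∘σ k)))))
    (inverseˡ σ))

  transport : ∀ {ρ ν} → InS n lam ρ → InS n lam ν → Fin n → Fin n
  transport (σ , _) (τ , _) i = τ ⟨$⟩ˡ (σ ⟨$⟩ʳ i)

  transport-label : ∀ {ρ ν} (hρ : InS n lam ρ) (hν : InS n lam ν) i → ν (transport hρ hν i) ≡ ρ i
  transport-label (σ , ρ≡lam∘σ) (τ , ν≡lam∘τ) i =
    ≡.trans (ν≡lam∘τ _) (≡.trans (≡.cong lam (inverseʳ τ)) (≡.sym (ρ≡lam∘σ i)))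

  distinctRearrangement : ∀ {ρ ν} → InS n lam ρ → InS n lam ν → DistinctRearrangement ρ ν
  distinctRearrangement hρ hν = record
    { ρ-injective = InS-injective hρ
    ; ν-injective = InS-injective hν
    ; dest        = transport hρ hν
    ; ν∘dest      = transport-label hρ hν
    ; origin      = transport hν hρ
    ; ρ∘origin    = transport-label hν hρ
    }

-- The coefficient c^ρ_ν as a product of site weights

module Factorisation {c ℓ} (F : Field c ℓ) (n : ℕ) (x : Fin n → Field.Carrier F) (t : Field.Carrier F)
                     {ρ ν : Fin n → ℕ} (R : DistinctRearrangement ρ ν) where
  open WithField F renaming (refl to ≈-refl)
  open Params n x t
  open BigOperators F
  open FieldFacts F
  open DistinctRearrangement R
  open import Relation.Binary.Reasoning.Setoid setoid

  -- colOK and pairWt at a single column i carrying the top label s, with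
  -- t^(skipped + emp) already evaluated as a product of skipWt (t^[skipped+emp]).
  skipWt : Fin n → Fin n → Fin n → Carrier
  skipWt i k c = if between i k c ∧ (ν c ℕ.<ᵇ ρ i) then t else 1#

  signOK : ℤ → Fin n → Fin n → Bool
  signOK s k i = if isPos s
    then (not (ν i ==ᵇ 0) ∧ (∣ s ∣ ≤ᵇ ν i) ∧ (if ν i ==ᵇ ∣ s ∣ then k ==ᶠ i else true))
    else ((ν i ==ᵇ 0) ∨ (ν i ≤ᵇ ∣ s ∣))

  columnOK : ℤ → Maybe (Fin n) → Fin n → Bool
  columnOK s nothing  i = isZero s
  columnOK s (just k) i =
    not (isZero s) ∧ ⌊ toℕ i ℕ.≤? toℕ k ⌋ ∧ not (ν k ==ᵇ 0) ∧ (∣ s ∣ ==ᵇ ν k) ∧ signOK s k i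

  columnWt : ℤ → Maybe (Fin n) → Fin n → Carrier
  columnWt s nothing  i = 1#
  columnWt s (just k) i = if i <ᶠ k then (if isPos s then w else - w) else 1#
    where w = (1# - t) * Πᴸ (allFin n) (skipWt i k)

  columnTerm : Fin n → ℤ → Maybe (Fin n) → Carrier
  columnTerm i s v = if columnOK s v i then columnWt s v i else 0#

  colOK≡columnOK : ∀ α m i → colOK α ν m i ≡ columnOK (α i) (m i) i
  colOK≡columnOK α m i with m i
  ... | nothing = refl
  ... | just k  = refl

  columnOK-just⁻ : ∀ s k i → columnOK s (just k) i ≡ true → isZero s ≡ false × ∣ s ∣ ≡ ν k
  columnOK-just⁻ s k i ok
    with s≢0 , ok₁ ← ∧-true⁻ {not (isZero s)} ok
    with _ , ok₂ ← ∧-true⁻ {⌊ toℕ i ℕ.≤? toℕ k ⌋} ok₁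
    with _ , ok₃ ← ∧-true⁻ {not (ν k ==ᵇ 0)} ok₂
    = Boolₚ.not-injective s≢0 , ==ᵇ-true⁻ (proj₁ (∧-true⁻ {∣ s ∣ ==ᵇ ν k} ok₃))

  module ValidPairing (α : Fin n → ℤ) (|α|≡ρ : ∀ i → ∣ α i ∣ ≡ ρ i) (m : Fin n → Maybe (Fin n))
                      (valid : ∀ i → columnOK (α i) (m i) i ≡ true) where

    matched⁻ : ∀ {i k} → m i ≡ just k → ρ i ≡ ν k × ρ i ≢ 0
    matched⁻ {i} {k} e
      with α≢0 , |α|≡ν ← columnOK-just⁻ (α i) k i (≡.subst (λ v → columnOK (α i) v i ≡ true) e (valid i))
      = ≡.trans (≡.sym (|α|≡ρ i)) |α|≡ν , isZero-false⁻ (α i) α≢0 ∘ ≡.trans (|α|≡ρ i)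

    ν≢ρ-before-match : ∀ {i k c} → m i ≡ just k → c < k → ν c ≢ ρ i
    ν≢ρ-before-match e c<k νc≡ρi = ℕₚ.<-irrefl (≡.cong toℕ (ν-injective (≡.trans νc≡ρi (proj₁ (matched⁻ e))))) c<k

    matched-origin : ∀ {i k} → m i ≡ just k → i ≡ origin k
    matched-origin e = origin-unique (proj₁ (matched⁻ e))

    origin-matched : ∀ {k} → ν k ≢ 0 → m (origin k) ≡ just k
    origin-matched {k} νk≢0 with m (origin k) in e
    ... | just k′ = ≡.cong just (ν-injective (≡.trans (≡.sym (proj₁ (matched⁻ e))) (ρ∘origin k)))
    ... | nothing = ⊥-elim (νk≢0 (≡.trans (≡.sym (ρ∘origin k)) (≡.trans (≡.sym (|α|≡ρ (origin k)))
                      (isZero-true⁻ _ (≡.subst (λ v → columnOK _ v (origin k) ≡ true) e (valid (origin k)))))))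

    injOK-valid : injOK m ≡ true
    injOK-valid = allᶠ-true _ λ i → allᶠ-true _ λ i′ → allᶠ-true _ λ k → unique i i′ k
      where
      unique : ∀ i i′ k → (if isJust (m i) k ∧ isJust (m i′) k then i ==ᶠ i′ else true) ≡ true
      unique i i′ k with isJust (m i) k in e | isJust (m i′) k in e′
      ... | true  | true  = ==ᶠ-true (≡.trans (matched-origin (isJust-true⁻ (m i) e))
                                              (≡.sym (matched-origin (isJust-true⁻ (m i′) e′))))
      ... | true  | false = refl
      ... | false | _     = refl

    matched-earlier : ∀ {i k c} → m i ≡ just k → c < k → ν c ≢ 0 →
            anyᶠ (λ i′ → before α i′ i ∧ isJust (m i′) c) ≡ (ρ i ℕ.<ᵇ ν c)
    matched-earlier {i} {k} {c} e c<k νc≢0 = ≡.trans (anyᶠ-single _ (origin c) others) at-origin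
      where
      others : ∀ i′ → i′ ≢ origin c → before α i′ i ∧ isJust (m i′) c ≡ false
      others i′ i′≢ with isJust (m i′) c in e′
      ... | true  = ⊥-elim (i′≢ (matched-origin (isJust-true⁻ (m i′) e′)))
      ... | false = Boolₚ.∧-zeroʳ _
      at-origin : before α (origin c) i ∧ isJust (m (origin c)) c ≡ (ρ i ℕ.<ᵇ ν c)
      at-origin rewrite origin-matched νc≢0 | ==ᶠ-true {i = c} refl | Boolₚ.∧-identityʳ (before α (origin c) i)
                      | |α|≡ρ i | |α|≡ρ (origin c) | ρ∘origin c | ==ᵇ-false (ν≢ρ-before-match e c<k) = Boolₚ.∨-identityʳ _

    t^[skipped+emp] : ∀ {i k} → m i ≡ just k → t ^ᴺ (skipped α ν m i k ℕ.+ emp ν i k) ≈ Πᴸ (allFin n) (skipWt i k)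
    t^[skipped+emp] {i} {k} e = begin
      t ^ᴺ (skipped α ν m i k ℕ.+ emp ν i k)    ≈⟨ ^ᴺ-+ t (skipped α ν m i k) (emp ν i k) ⟩
      t ^ᴺ skipped α ν m i k * t ^ᴺ emp ν i k   ≈⟨ *-cong (Πᴸ-if-count _ (allFin n) t) (Πᴸ-if-count _ (allFin n) t) ⟩
      Πᴸ (allFin n) _ * Πᴸ (allFin n) _         ≈⟨ Πᴸ-* (allFin n) _ _ ⟨
      Πᴸ (allFin n) _                           ≈⟨ Πᴸ-cong (allFin n) column ⟩
      Πᴸ (allFin n) (skipWt i k)                ∎
      where
      column : ∀ c → (if between i k c ∧ not (ν c ==ᵇ 0) ∧ not (anyᶠ (λ i′ → before α i′ i ∧ isJust (m i′) c))
                        then t else 1#) * (if between i k c ∧ (ν c ==ᵇ 0) then t else 1#)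
                     ≈ (if between i k c ∧ (ν c ℕ.<ᵇ ρ i) then t else 1#)
      column c with between i k c in b
      ... | false = *-identityˡ 1#
      ... | true with ν c ==ᵇ 0 in z
      ...   | true  rewrite ==ᵇ-true⁻ z | <ᵇ-true (ℕₚ.n≢0⇒n>0 (proj₂ (matched⁻ e))) = *-identityˡ t
      ...   | false = trans (*-identityʳ _) (reflexive (Boolₚ.if-cong
                        (≡.trans (≡.cong not (matched-earlier e c<k (==ᵇ-false⁻ z))) (not-<ᵇ (ν≢ρ-before-match e c<k)))))
        where c<k = <ᶠ-true⁻ (proj₂ (∧-true⁻ b))

    pairWt≈columnWt : ∀ i → pairWt α ν m i ≈ columnWt (α i) (m i) i
    pairWt≈columnWt i with m i in e
    ... | nothing = ≈-refl
    ... | just k  = if-≈ (i <ᶠ k) (if-≈ (isPos (α i)) (*-congˡ w≈) (-‿cong (*-congˡ w≈))) ≈-refl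
      where w≈ = t^[skipped+emp] e

  stlqTerm≈Πcolumns : ∀ α → (∀ i → ∣ α i ∣ ≡ ρ i) → ∀ m →
    (if IsSTLQ α ν m then wtQ α ν m else 0#) ≈ Πᴸ (allFin n) (λ i → columnTerm i (α i) (m i))
  stlqTerm≈Πcolumns α |α|≡ρ m with allᶠ (colOK α ν m) in ok
  ... | true = begin
      (if injOK m then wtQ α ν m else 0#)  ≡⟨ Boolₚ.if-cong injOK-valid ⟩
      Πᴸ (allFin n) (pairWt α ν m)         ≈⟨ Πᴸ-cong (allFin n) (λ i → trans (pairWt≈columnWt i) (reflexive (≡.cong
                                                (λ b → if b then columnWt (α i) (m i) i else 0#) (≡.sym (valid i))))) ⟩
      Πᴸ (allFin n) (λ i → columnTerm i (α i) (m i)) ∎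
    where
    valid : ∀ i → columnOK (α i) (m i) i ≡ true
    valid i = ≡.trans (≡.sym (colOK≡columnOK α m i)) (allᶠ-true⁻ _ ok i)
    open ValidPairing α |α|≡ρ m valid
  ... | false with i , bad ← allᶠ-false⁻ _ ok =
      sym (Πᴸ-zero (∈-allFin i) (reflexive (Boolₚ.if-cong
                                                    (≡.trans (≡.sym (colOK≡columnOK α m i)) bad))))

  pairings : List (Maybe (Fin n))
  pairings = nothing ∷ map just (allFin n)

  signWt : Fin n → ℤ → Carrier
  signWt k s = if isPos s then x k else (if isNeg s then - t₁ else 1#)

  bCoef≈Πcolumns : ∀ α → (∀ i → ∣ α i ∣ ≡ ρ i) →
                   bCoef α ν ≈ Πᴸ (allFin n) (λ i → Σᴸ pairings (columnTerm i (α i)))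
  bCoef≈Πcolumns α |α|≡ρ = begin
    bCoef α ν
      ≈⟨ Σᴸ-cong (allFuns n pairings) (stlqTerm≈Πcolumns α |α|≡ρ) ⟩
    Σᴸ (allFuns n pairings) (λ m → Πᴸ (allFin n) (λ i → columnTerm i (α i) (m i)))
      ≡⟨ ≡.cong (λ ms → Σᴸ ms (λ m → Πᴸ (allFin n) (λ i → columnTerm i (α i) (m i)))) (allFuns≡cartesian n pairings) ⟩
    Σᴸ (cartesian (λ _ → pairings)) (λ m → Πᴸ (allFin n) (λ i → columnTerm i (α i) (m i)))
      ≈⟨ Σᴸ-cartesian (λ _ → pairings) (λ i → columnTerm i (α i)) ⟩
    Πᴸ (allFin n) (λ i → Σᴸ pairings (columnTerm i (α i))) ∎

  columnSum : Fin n → Carrier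
  columnSum i = Σᴸ (signs (ρ i)) (λ s → signWt i s * Σᴸ pairings (columnTerm i s))

  cCoef≈ΠcolumnSum : cCoef ρ ν ≈ Πᴸ (allFin n) columnSum
  cCoef≈ΠcolumnSum = begin
    cCoef ρ ν
      ≡⟨ ≡.cong (λ αs → Σᴸ αs (λ α → wtα α * bCoef α ν)) (signings≡cartesian ρ) ⟩
    Σᴸ (cartesian (signs ∘ ρ)) (λ α → wtα α * bCoef α ν)
      ≈⟨ Σᴸ-cong-∈ (cartesian (signs ∘ ρ)) (λ {α} α∈ → begin
           wtα α * bCoef α ν
             ≈⟨ *-congˡ (bCoef≈Πcolumns α (λ i → ∈-signs⁻ (∈-cartesian⁻ (signs ∘ ρ) α∈ i))) ⟩
           Πᴸ (allFin n) (λ i → signWt i (α i)) * Πᴸ (allFin n) (λ i → Σᴸ pairings (columnTerm i (α i)))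
             ≈⟨ Πᴸ-* (allFin n) _ _ ⟨
           Πᴸ (allFin n) (λ i → signWt i (α i) * Σᴸ pairings (columnTerm i (α i))) ∎) ⟩
    Σᴸ (cartesian (signs ∘ ρ)) (λ α → Πᴸ (allFin n) (λ i → signWt i (α i) * Σᴸ pairings (columnTerm i (α i))))
      ≈⟨ Σᴸ-cartesian (signs ∘ ρ) (λ i s → signWt i s * Σᴸ pairings (columnTerm i s)) ⟩
    Πᴸ (allFin n) columnSum ∎

  -- The vacancy contributes 1 and no label can move left.  A label staying in
  -- place allows both signs, x_i − t^{1−n}; a label moving right allows exactly
  -- one sign by (iii)/(iv), depending on whether ν_i ≤ ρ_i.
  columnFactor : Fin n → Carrier
  columnFactor i =
    if ρ i ==ᵇ 0 then 1#
    else if toℕ (dest i) ℕ.<ᵇ toℕ i then 0#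
    else if dest i ==ᶠ i then x i - t₁
    else (if ν i ≤ᵇ ρ i then t₁ else x i) * (1# - t)

  module _ {i : Fin n} where

    columnFactor-vacancy : ρ i ≡ 0 → columnFactor i ≡ 1#
    columnFactor-vacancy ρi≡0 rewrite ρi≡0 = refl

    columnFactor-backward : ρ i ≢ 0 → dest i < i → columnFactor i ≡ 0#
    columnFactor-backward ρi≢0 d<i rewrite ==ᵇ-false ρi≢0 | <ᵇ-true d<i = refl

    columnFactor-fixed : ρ i ≢ 0 → dest i ≡ i → columnFactor i ≡ x i - t₁
    columnFactor-fixed ρi≢0 d≡i
      rewrite ==ᵇ-false ρi≢0 | <ᵇ-false (ℕₚ.<-irrefl (≡.cong toℕ d≡i)) | ==ᶠ-true d≡i = refl

    columnFactor-forward : ρ i ≢ 0 → i < dest i → columnFactor i ≡ (if ν i ≤ᵇ ρ i then t₁ else x i) * (1# - t)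
    columnFactor-forward ρi≢0 i<d
      rewrite ==ᵇ-false ρi≢0 | <ᵇ-false (ℕₚ.<⇒≯ i<d)
            | ==ᶠ-false (λ d≡i → ℕₚ.<-irrefl (≡.cong toℕ (≡.sym d≡i)) i<d) = refl

  skipWt-trivial : ∀ {i k c} → between i k c ∧ (ν c ℕ.<ᵇ ρ i) ≡ false → skipWt i k c ≈ 1#
  skipWt-trivial e = reflexive (Boolₚ.if-cong e)

  Πskip-vacancy : ∀ {i k} → ρ i ≡ 0 → Πᴸ (allFin n) (skipWt i k) ≈ 1#
  Πskip-vacancy {i} {k} ρi≡0 = trans (Πᴸ-cong (allFin n) λ c → skipWt-trivial
    (≡.trans (≡.cong (λ r → between i k c ∧ (ν c ℕ.<ᵇ r)) ρi≡0) (Boolₚ.∧-zeroʳ _))) (Πᴸ-1 (allFin n))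

  Πskip-self : ∀ {i} → Πᴸ (allFin n) (skipWt i i) ≈ 1#
  Πskip-self {i} = trans (Πᴸ-cong (allFin n) λ c → skipWt-trivial (nowhere c)) (Πᴸ-1 (allFin n))
    where
    nowhere : ∀ c → between i i c ∧ (ν c ℕ.<ᵇ ρ i) ≡ false
    nowhere c with i <ᶠ c in i<c
    ... | false = refl
    ... | true rewrite <ᶠ-false (ℕₚ.<-asym (<ᶠ-true⁻ i<c)) = refl

  Σpairings≈dest : ∀ {i s} → isZero s ≡ false → ∣ s ∣ ≡ ρ i →
                   Σᴸ pairings (columnTerm i s) ≈ columnTerm i s (just (dest i))
  Σpairings≈dest {i} {s} s≢0 |s|≡ρi = begin
    columnTerm i s nothing + Σᴸ (map just (allFin n)) (columnTerm i s)
      ≡⟨ ≡.cong₂ _+_ (Boolₚ.if-cong s≢0) (Σᴸ-map just (allFin n) (columnTerm i s)) ⟩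
    0# + Σᴸ (allFin n) (λ k → columnTerm i s (just k))
      ≈⟨ +-identityˡ _ ⟩
    Σᴸ (allFin n) (λ k → columnTerm i s (just k))
      ≈⟨ Σᴸ-single n (dest i) _ off-dest ⟩
    columnTerm i s (just (dest i)) ∎
    where
    off-dest : ∀ k → k ≢ dest i → columnTerm i s (just k) ≈ 0#
    off-dest k k≢d with columnOK s (just k) i in ok
    ... | true  = ⊥-elim (k≢d (dest-unique (≡.trans (≡.sym (proj₂ (columnOK-just⁻ s k i ok))) |s|≡ρi)))
    ... | false = ≈-refl

  columnOK-dest : ∀ {i s} → isZero s ≡ false → ∣ s ∣ ≡ ρ i →
                  columnOK s (just (dest i)) i ≡ ⌊ toℕ i ℕ.≤? toℕ (dest i) ⌋ ∧ signOK s (dest i) i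
  columnOK-dest {i} {s} s≢0 |s|≡ρi
    rewrite s≢0 | ==ᵇ-false (isZero-false⁻ s s≢0 ∘ ≡.trans |s|≡ρi ∘ ≡.trans (≡.sym (ν∘dest i)))
          | ==ᵇ-true (≡.trans |s|≡ρi (≡.sym (ν∘dest i))) = refl

  module _ {i k : Fin n} where

    columnWt-not-forward : ∀ {s} → ¬ i < k → columnWt s (just k) i ≡ 1#
    columnWt-not-forward i≮k rewrite <ᶠ-false i≮k = refl

    columnWt-forward⁺ : ∀ {a} → i < k → columnWt (+ suc a) (just k) i ≡ (1# - t) * Πᴸ (allFin n) (skipWt i k)
    columnWt-forward⁺ i<k rewrite <ᶠ-true i<k = refl

    columnWt-forward⁻ : ∀ {a} → i < k → columnWt -[1+ a ] (just k) i ≡ - ((1# - t) * Πᴸ (allFin n) (skipWt i k))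
    columnWt-forward⁻ i<k rewrite <ᶠ-true i<k = refl

  module ColumnOfLabel {i a} (ρi≡1+a : ρ i ≡ suc a) where

    Πskip : Carrier
    Πskip = Πᴸ (allFin n) (skipWt i (dest i))

    term : ℤ → Carrier
    term s = columnTerm i s (just (dest i))

    columnSum≈terms : columnSum i ≈ x i * term (+ suc a) + - t₁ * term -[1+ a ]
    columnSum≈terms = begin
      columnSum i
        ≡⟨ ≡.cong (λ r → Σᴸ (signs r) (λ s → signWt i s * Σᴸ pairings (columnTerm i s))) ρi≡1+a ⟩
      x i * Σᴸ pairings (columnTerm i (+ suc a)) + (- t₁ * Σᴸ pairings (columnTerm i -[1+ a ]) + 0#)
        ≈⟨ +-cong (*-congˡ (Σpairings≈dest refl (≡.sym ρi≡1+a)))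
                  (trans (+-identityʳ _) (*-congˡ (Σpairings≈dest refl (≡.sym ρi≡1+a)))) ⟩
      x i * term (+ suc a) + - t₁ * term -[1+ a ] ∎

    term≡ : ∀ s → isZero s ≡ false → ∣ s ∣ ≡ suc a → ∀ {b} →
            ⌊ toℕ i ℕ.≤? toℕ (dest i) ⌋ ∧ signOK s (dest i) i ≡ b →
            term s ≡ (if b then columnWt s (just (dest i)) i else 0#)
    term≡ s s≢0 |s|≡ e =
      Boolₚ.if-cong (≡.trans (columnOK-dest s≢0 (≡.trans |s|≡ (≡.sym ρi≡1+a))) e)

    ρi≢0 : ρ i ≢ 0
    ρi≢0 ρi≡0 with () ← ≡.trans (≡.sym ρi≡1+a) ρi≡0

    backward : dest i < i → x i * term (+ suc a) + - t₁ * term -[1+ a ] ≈ columnFactor i * Πskip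
    backward d<i = begin
      x i * term (+ suc a) + - t₁ * term -[1+ a ]
        ≡⟨ ≡.cong₂ (λ u v → x i * u + - t₁ * v) (term≡ (+ suc a) refl refl (i≰d {+ suc a}))
                                                (term≡ -[1+ a ] refl refl (i≰d { -[1+ a ]})) ⟩
      x i * 0# + - t₁ * 0#  ≈⟨ +-cong (zeroʳ _) (zeroʳ _) ⟩
      0# + 0#               ≈⟨ +-identityʳ 0# ⟩
      0#                    ≈⟨ zeroˡ _ ⟨
      0# * Πskip            ≡⟨ ≡.cong (_* Πskip) (≡.sym (columnFactor-backward ρi≢0 d<i)) ⟩
      columnFactor i * Πskip ∎
      where
      i≰d : ∀ {s} → ⌊ toℕ i ℕ.≤? toℕ (dest i) ⌋ ∧ signOK s (dest i) i ≡ false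
      i≰d {s} = ≡.cong (_∧ signOK s (dest i) i) (⌊⌋-false (toℕ i ℕ.≤? toℕ (dest i)) (ℕₚ.<⇒≱ d<i))

    fixed : dest i ≡ i → x i * term (+ suc a) + - t₁ * term -[1+ a ] ≈ columnFactor i * Πskip
    fixed d≡i = begin
      x i * term (+ suc a) + - t₁ * term -[1+ a ]
        ≡⟨ ≡.cong₂ (λ u v → x i * u + - t₁ * v)
                   (≡.trans (term≡ (+ suc a) refl refl ok⁺) (columnWt-not-forward {s = + suc a} i≮d))
                   (≡.trans (term≡ -[1+ a ] refl refl ok⁻) (columnWt-not-forward {s = -[1+ a ]} i≮d)) ⟩
      x i * 1# + - t₁ * 1#  ≈⟨ +-cong (*-identityʳ _) (*-identityʳ _) ⟩
      x i - t₁              ≈⟨ *-identityʳ _ ⟨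
      (x i - t₁) * 1#       ≈⟨ *-cong (reflexive (≡.sym (columnFactor-fixed ρi≢0 d≡i)))
                                      (sym (trans (reflexive (≡.cong (λ k → Πᴸ (allFin n) (skipWt i k)) d≡i)) Πskip-self)) ⟩
      columnFactor i * Πskip ∎
      where
      i≮d : ¬ i < dest i
      i≮d = ℕₚ.<-irrefl (≡.cong toℕ (≡.sym d≡i))
      νi≡1+a : ν i ≡ suc a
      νi≡1+a = ≡.trans (≡.cong ν (≡.sym d≡i)) (≡.trans (ν∘dest i) ρi≡1+a)
      i≤d : toℕ i ℕ.≤ toℕ (dest i)
      i≤d = ℕₚ.≤-reflexive (≡.cong toℕ (≡.sym d≡i))
      ok⁺ : ⌊ toℕ i ℕ.≤? toℕ (dest i) ⌋ ∧ signOK (+ suc a) (dest i) i ≡ true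
      ok⁺ rewrite ⌊⌋-true (toℕ i ℕ.≤? toℕ (dest i)) i≤d | νi≡1+a | ≤ᵇ-true (ℕₚ.≤-refl {suc a})
                | ==ᵇ-true {suc a} refl | ==ᶠ-true d≡i = refl
      ok⁻ : ⌊ toℕ i ℕ.≤? toℕ (dest i) ⌋ ∧ signOK -[1+ a ] (dest i) i ≡ true
      ok⁻ rewrite ⌊⌋-true (toℕ i ℕ.≤? toℕ (dest i)) i≤d | νi≡1+a | ≤ᵇ-true (ℕₚ.≤-refl {suc a}) = refl

    module Forward (i<d : i < dest i) where

      i≤d : toℕ i ℕ.≤ toℕ (dest i)
      i≤d = ℕₚ.<⇒≤ i<d

      νi≢1+a : ν i ≢ suc a
      νi≢1+a νi≡1+a = ℕₚ.<-irrefl (≡.cong toℕ (dest-unique (≡.trans νi≡1+a (≡.sym ρi≡1+a)))) i<d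

      label-smaller : ν i ℕ.≤ ρ i → x i * term (+ suc a) + - t₁ * term -[1+ a ] ≈ columnFactor i * Πskip
      label-smaller νi≤ρi = begin
        x i * term (+ suc a) + - t₁ * term -[1+ a ]
          ≡⟨ ≡.cong₂ (λ u v → x i * u + - t₁ * v) (term≡ (+ suc a) refl refl ok⁺)
                                                (≡.trans (term≡ -[1+ a ] refl refl ok⁻) (columnWt-forward⁻ {a = a} i<d)) ⟩
        x i * 0# + - t₁ * - ((1# - t) * Πskip)  ≈⟨ +-cong (zeroʳ _) ([-u]*[-v]≈u*v _ _) ⟩
        0# + t₁ * ((1# - t) * Πskip)            ≈⟨ +-identityˡ _ ⟩
        t₁ * ((1# - t) * Πskip)                 ≈⟨ *-assoc _ _ _ ⟨
        (t₁ * (1# - t)) * Πskip                 ≡⟨ ≡.cong (_* Πskip) (≡.sym (≡.trans (columnFactor-forward ρi≢0 i<d)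
                                                     (≡.cong (λ b → (if b then t₁ else x i) * (1# - t)) (≤ᵇ-true νi≤ρi)))) ⟩
        columnFactor i * Πskip                  ∎
        where
        νi≤a : ν i ℕ.≤ suc a
        νi≤a = ≡.subst (ν i ℕ.≤_) ρi≡1+a νi≤ρi
        ok⁺ : ⌊ toℕ i ℕ.≤? toℕ (dest i) ⌋ ∧ signOK (+ suc a) (dest i) i ≡ false
        ok⁺ rewrite ⌊⌋-true (toℕ i ℕ.≤? toℕ (dest i)) i≤d
                  | ≤ᵇ-false {suc a} {ν i} (λ 1+a≤νi → νi≢1+a (ℕₚ.≤-antisym νi≤a 1+a≤νi)) = Boolₚ.∧-zeroʳ _
        ok⁻ : ⌊ toℕ i ℕ.≤? toℕ (dest i) ⌋ ∧ signOK -[1+ a ] (dest i) i ≡ true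
        ok⁻ rewrite ⌊⌋-true (toℕ i ℕ.≤? toℕ (dest i)) i≤d | ≤ᵇ-true νi≤a = Boolₚ.∨-zeroʳ _

      label-larger : ¬ ν i ℕ.≤ ρ i → x i * term (+ suc a) + - t₁ * term -[1+ a ] ≈ columnFactor i * Πskip
      label-larger νi≰ρi = begin
        x i * term (+ suc a) + - t₁ * term -[1+ a ]
          ≡⟨ ≡.cong₂ (λ u v → x i * u + - t₁ * v) (≡.trans (term≡ (+ suc a) refl refl ok⁺) (columnWt-forward⁺ {a = a} i<d))
                                                (term≡ -[1+ a ] refl refl ok⁻) ⟩
        x i * ((1# - t) * Πskip) + - t₁ * 0#  ≈⟨ +-congˡ (zeroʳ _) ⟩
        x i * ((1# - t) * Πskip) + 0#         ≈⟨ +-identityʳ _ ⟩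
        x i * ((1# - t) * Πskip)              ≈⟨ *-assoc _ _ _ ⟨
        (x i * (1# - t)) * Πskip              ≡⟨ ≡.cong (_* Πskip) (≡.sym (≡.trans (columnFactor-forward ρi≢0 i<d)
                                                   (≡.cong (λ b → (if b then t₁ else x i) * (1# - t)) (≤ᵇ-false νi≰ρi)))) ⟩
        columnFactor i * Πskip                ∎
        where
        νi≰a : ¬ ν i ℕ.≤ suc a
        νi≰a = νi≰ρi ∘ ≡.subst (ν i ℕ.≤_) (≡.sym ρi≡1+a)
        νi≢0 : ν i ≢ 0
        νi≢0 νi≡0 = νi≰a (≡.subst (ℕ._≤ suc a) (≡.sym νi≡0) ℕ.z≤n)
        ok⁺ : ⌊ toℕ i ℕ.≤? toℕ (dest i) ⌋ ∧ signOK (+ suc a) (dest i) i ≡ true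
        ok⁺ rewrite ⌊⌋-true (toℕ i ℕ.≤? toℕ (dest i)) i≤d | ==ᵇ-false νi≢0
                  | ≤ᵇ-true {suc a} {ν i} (ℕₚ.<⇒≤ (ℕₚ.≰⇒> νi≰a)) | ==ᵇ-false νi≢1+a = refl
        ok⁻ : ⌊ toℕ i ℕ.≤? toℕ (dest i) ⌋ ∧ signOK -[1+ a ] (dest i) i ≡ false
        ok⁻ rewrite ⌊⌋-true (toℕ i ℕ.≤? toℕ (dest i)) i≤d | ==ᵇ-false νi≢0 | ≤ᵇ-false νi≰a = refl

    columnSum-label : columnSum i ≈ columnFactor i * Πskip
    columnSum-label = trans columnSum≈terms (byPosition (ℕₚ.<-cmp (toℕ (dest i)) (toℕ i)))
      where
      byOrder : i < dest i → Dec (ν i ℕ.≤ ρ i) → x i * term (+ suc a) + - t₁ * term -[1+ a ] ≈ columnFactor i * Πskip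
      byOrder i<d (yes νi≤ρi) = Forward.label-smaller i<d νi≤ρi
      byOrder i<d (no  νi≰ρi) = Forward.label-larger i<d νi≰ρi
      byPosition : Tri (dest i < i) (toℕ (dest i) ≡ toℕ i) (i < dest i) →
                   x i * term (+ suc a) + - t₁ * term -[1+ a ] ≈ columnFactor i * Πskip
      byPosition (tri< d<i _ _) = backward d<i
      byPosition (tri≈ _ d≡i _) = fixed (Finₚ.toℕ-injective d≡i)
      byPosition (tri> _ _ i<d) = byOrder i<d (ν i ℕ.≤? ρ i)

  columnSum-vacancy : ∀ {i} → ρ i ≡ 0 → columnSum i ≈ columnFactor i * Πᴸ (allFin n) (skipWt i (dest i))
  columnSum-vacancy {i} ρi≡0 = begin
    columnSum i
      ≡⟨ ≡.cong (λ r → Σᴸ (signs r) (λ s → signWt i s * Σᴸ pairings (columnTerm i s))) ρi≡0 ⟩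
    1# * (1# + Σᴸ (map just (allFin n)) (columnTerm i (+ 0))) + 0#
      ≈⟨ trans (+-identityʳ _) (*-identityˡ _) ⟩
    1# + Σᴸ (map just (allFin n)) (columnTerm i (+ 0))
      ≈⟨ +-congˡ (trans (reflexive (Σᴸ-map just (allFin n) (columnTerm i (+ 0)))) (Σᴸ-0 (allFin n))) ⟩
    1# + 0#
      ≈⟨ +-identityʳ 1# ⟩
    1#
      ≈⟨ *-identityʳ 1# ⟨
    1# * 1#
      ≈⟨ *-cong (reflexive (≡.sym (columnFactor-vacancy ρi≡0))) (sym (Πskip-vacancy ρi≡0)) ⟩
    columnFactor i * Πᴸ (allFin n) (skipWt i (dest i)) ∎

  columnSum≈ : ∀ i → columnSum i ≈ columnFactor i * Πᴸ (allFin n) (skipWt i (dest i))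
  columnSum≈ i = byLabel (ρ i) refl
    where
    byLabel : ∀ r → ρ i ≡ r → columnSum i ≈ columnFactor i * Πᴸ (allFin n) (skipWt i (dest i))
    byLabel zero    ρi≡0   = columnSum-vacancy ρi≡0
    byLabel (suc a) ρi≡1+a = ColumnOfLabel.columnSum-label ρi≡1+a

  crossingWt : Fin n → Carrier
  crossingWt c = Πᴸ (allFin n) (λ i → skipWt i (dest i) c)

  siteWt : Fin n → Carrier
  siteWt c = columnFactor c * crossingWt c

  cCoef≈ΠsiteWt : cCoef ρ ν ≈ Πᴸ (allFin n) siteWt
  cCoef≈ΠsiteWt = begin
    cCoef ρ ν
      ≈⟨ cCoef≈ΠcolumnSum ⟩
    Πᴸ (allFin n) columnSum
      ≈⟨ Πᴸ-cong (allFin n) columnSum≈ ⟩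
    Πᴸ (allFin n) (λ i → columnFactor i * Πᴸ (allFin n) (skipWt i (dest i)))
      ≈⟨ Πᴸ-* (allFin n) _ _ ⟩
    Πᴸ (allFin n) columnFactor * Πᴸ (allFin n) (λ i → Πᴸ (allFin n) (skipWt i (dest i)))
      ≈⟨ *-congˡ (Πᴸ-swap (allFin n) (allFin n) (λ i → skipWt i (dest i))) ⟩
    Πᴸ (allFin n) columnFactor * Πᴸ (allFin n) crossingWt
      ≈⟨ Πᴸ-* (allFin n) _ _ ⟨
    Πᴸ (allFin n) siteWt ∎

  crossingWt-trivial : ∀ {k} → (∀ i → between i (dest i) k ≡ true → (ν k ℕ.<ᵇ ρ i) ≡ false) → crossingWt k ≈ 1#
  crossingWt-trivial {k} none = trans (Πᴸ-cong (allFin n) (λ i → skipWt-trivial (no-crossing i))) (Πᴸ-1 (allFin n))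
    where
    no-crossing : ∀ i → between i (dest i) k ∧ (ν k ℕ.<ᵇ ρ i) ≡ false
    no-crossing i with between i (dest i) k in crosses
    ... | true  = none i crosses
    ... | false = refl

  siteWt-backward : ∀ {i} → ρ i ≢ 0 → dest i < i → siteWt i ≈ 0#
  siteWt-backward ρi≢0 d<i = trans (*-congʳ (reflexive (columnFactor-backward ρi≢0 d<i))) (zeroˡ _)

-- The TASEP step as a product of site weights

module Run {c ℓ} (F : Field c ℓ) (n : ℕ) (x : Fin n → Field.Carrier F) (t : Field.Carrier F)
           {ρ ν : Fin n → ℕ} (R : DistinctRearrangement ρ ν) (j : Fin n) (ρj≡0 : ρ j ≡ 0) where
  open WithField F renaming (refl to ≈-refl)
  open Params n x t
  open BigOperators F
  open FieldFacts F
  open DistinctRearrangement R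
  open Factorisation F n x t R
  open import Relation.Binary.Reasoning.Setoid setoid
  open import Algebra.Properties.Ring ring using ([y-z]x≈yx-zx; x[y-z]≈xy-xz)

  module _ {k : Fin n} (xk≉t₂ : ¬ x k ≈ t₂) where

    private
      xk-t₂≉0 : ¬ x k - t₂ ≈ 0#
      xk-t₂≉0 = u≉v⇒u-v≉0 xk≉t₂

    𝔭*[x-t₂] : 𝔭 k * (x k - t₂) ≈ t₁ * (1# - t)
    𝔭*[x-t₂] = *⁻¹-cancelʳ xk-t₂≉0

    𝔮*[x-t₂] : 𝔮 k * (x k - t₂) ≈ x k * (1# - t)
    𝔮*[x-t₂] = trans (*⁻¹-cancelʳ xk-t₂≉0) (*-comm _ _)

    module _ (t≉0 : ¬ t ≈ 0#) where

      [1-𝔭]*[x-t₂] : (1# - 𝔭 k) * (x k - t₂) ≈ x k - t₁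
      [1-𝔭]*[x-t₂] = begin
        (1# - 𝔭 k) * (x k - t₂)                   ≈⟨ [y-z]x≈yx-zx _ _ _ ⟩
        1# * (x k - t₂) - 𝔭 k * (x k - t₂)        ≈⟨ +-cong (*-identityˡ _) (-‿cong 𝔭*[x-t₂]) ⟩
        (x k - t₂) - t₁ * (1# - t)                ≈⟨ +-congˡ (-‿cong (x[y-z]≈xy-xz _ _ _)) ⟩
        (x k - t₂) - (t₁ * 1# - t₁ * t)           ≈⟨ +-congˡ (-‿cong (+-cong (*-identityʳ _)
                                                                        (-‿cong (t^[1-n]*t≈t^[2-n] t≉0 k)))) ⟩
        (x k - t₂) - (t₁ - t₂)                    ≈⟨ [u-w]-[v-w] _ _ _ ⟩
        x k - t₁                                  ∎

      [1-𝔮]*[x-t₂] : (1# - 𝔮 k) * (x k - t₂) ≈ (x k - t₁) * t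
      [1-𝔮]*[x-t₂] = begin
        (1# - 𝔮 k) * (x k - t₂)                   ≈⟨ [y-z]x≈yx-zx _ _ _ ⟩
        1# * (x k - t₂) - 𝔮 k * (x k - t₂)        ≈⟨ +-cong (*-identityˡ _) (-‿cong 𝔮*[x-t₂]) ⟩
        (x k - t₂) - x k * (1# - t)               ≈⟨ +-congˡ (-‿cong (x[y-z]≈xy-xz _ _ _)) ⟩
        (x k - t₂) - (x k * 1# - x k * t)         ≈⟨ +-congˡ (-‿cong (+-congʳ (*-identityʳ _))) ⟩
        (x k - t₂) - (x k - x k * t)              ≈⟨ [u-v]-[u-w] _ _ _ ⟩
        x k * t - t₂                              ≈⟨ +-congˡ (-‿cong (t^[1-n]*t≈t^[2-n] t≉0 k)) ⟨
        x k * t - t₁ * t                          ≈⟨ [y-z]x≈yx-zx _ _ _ ⟨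
        (x k - t₁) * t                            ∎

  denomFactor : Fin n → Carrier
  denomFactor k = if k <ᶠ j then x k - t₂ else (if j <ᶠ k then x k - t₁ else 1#)

  denomFactor-before : ∀ {k} → k < j → denomFactor k ≡ x k - t₂
  denomFactor-before k<j rewrite <ᶠ-true k<j = refl

  denomFactor-j : denomFactor j ≡ 1#
  denomFactor-j rewrite <ᶠ-false (ℕₚ.<-irrefl {toℕ j} refl) = refl

  denomFactor-after : ∀ {k} → j < k → denomFactor k ≡ x k - t₁
  denomFactor-after j<k rewrite <ᶠ-false (ℕₚ.<⇒≯ j<k) | <ᶠ-true j<k = refl

  Πfrom : ℕ → (Fin n → Carrier) → Carrier
  Πfrom c₀ f = Πᴸ (allFin n) (λ k → if c₀ ≤ᵇ toℕ k then f k else 1#)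

  Πfrom-cong : ∀ c₀ {f g : Fin n → Carrier} → (∀ k → c₀ ℕ.≤ toℕ k → f k ≈ g k) → Πfrom c₀ f ≈ Πfrom c₀ g
  Πfrom-cong c₀ f≈g = Πᴸ-cong (allFin n) pointwise
    where
    pointwise : ∀ k → (if c₀ ≤ᵇ toℕ k then _ else 1#) ≈ (if c₀ ≤ᵇ toℕ k then _ else 1#)
    pointwise k with c₀ ≤ᵇ toℕ k in c₀≤k
    ... | true  = f≈g k (≤ᵇ-true⁻ c₀≤k)
    ... | false = ≈-refl

  Πfrom-zero : ∀ {c₀} {f : Fin n → Carrier} k → c₀ ℕ.≤ toℕ k → f k ≈ 0# → Πfrom c₀ f ≈ 0#
  Πfrom-zero {f = f} k c₀≤k fk≈0 =
    Πᴸ-zero (∈-allFin k) (trans (reflexive (Boolₚ.if-cong (≤ᵇ-true c₀≤k))) fk≈0)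

  Πfrom-step : ∀ (f : Fin n → Carrier) {k c₀} → toℕ k ≡ c₀ → Πfrom c₀ f ≈ f k * Πfrom (suc c₀) f
  Πfrom-step f {k} {c₀} k≡c₀ = begin
    Πfrom c₀ f
      ≈⟨ Πᴸ-cong (allFin n) split ⟩
    Πᴸ (allFin n) (λ k′ → (if k′ ==ᶠ k then f k′ else 1#) * (if suc c₀ ≤ᵇ toℕ k′ then f k′ else 1#))
      ≈⟨ Πᴸ-* (allFin n) _ _ ⟩
    Πᴸ (allFin n) (λ k′ → if k′ ==ᶠ k then f k′ else 1#) * Πfrom (suc c₀) f
      ≈⟨ *-congʳ (Πᴸ-single n k _ (λ k′ k′≢k → reflexive (Boolₚ.if-cong (==ᶠ-false k′≢k)))) ⟩
    (if k ==ᶠ k then f k else 1#) * Πfrom (suc c₀) f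
      ≡⟨ ≡.cong (λ b → (if b then f k else 1#) * Πfrom (suc c₀) f) (==ᶠ-true {i = k} refl) ⟩
    f k * Πfrom (suc c₀) f ∎
    where
    split : ∀ k′ → (if c₀ ≤ᵇ toℕ k′ then f k′ else 1#)
                   ≈ (if k′ ==ᶠ k then f k′ else 1#) * (if suc c₀ ≤ᵇ toℕ k′ then f k′ else 1#)
    split k′ with ℕₚ.<-cmp (toℕ k′) c₀
    ... | tri< k′<c₀ _ _
      rewrite ≤ᵇ-false (ℕₚ.<⇒≱ k′<c₀) | ≤ᵇ-false (ℕₚ.<⇒≱ (ℕₚ.m<n⇒m<1+n k′<c₀))
            | ==ᶠ-false (λ k′≡k → ℕₚ.<-irrefl (≡.trans (≡.cong toℕ k′≡k) k≡c₀) k′<c₀) = sym (*-identityˡ 1#)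
    ... | tri≈ _ k′≡c₀ _
      rewrite ≤ᵇ-true (ℕₚ.≤-reflexive (≡.sym k′≡c₀)) | ≤ᵇ-false (ℕₚ.<-irrefl (≡.sym k′≡c₀))
            | ==ᶠ-true (Finₚ.toℕ-injective (≡.trans k′≡c₀ (≡.sym k≡c₀))) = sym (*-identityʳ _)
    ... | tri> _ _ c₀<k′
      rewrite ≤ᵇ-true (ℕₚ.<⇒≤ c₀<k′) | ≤ᵇ-true c₀<k′
            | ==ᶠ-false (λ k′≡k → ℕₚ.<-irrefl (≡.sym (≡.trans (≡.cong toℕ k′≡k) k≡c₀)) c₀<k′) = sym (*-identityˡ _)

  run-vanishes : ∀ ks conf a {c} → All (_≢ c) ks → c ≢ j → conf c ≢ ν c → run ν j ks conf a ≈ 0#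
  run-vanishes [] conf a {c} All.[] c≢j conf≢ν = reflexive (Boolₚ.if-cong
    (⌊⌋-false (Finₚ.all? (λ i → upd conf j a i ℕ.≟ ν i))
              (λ agree → conf≢ν (≡.trans (≡.sym (upd-other conf j a c≢j)) (agree c)))))
  run-vanishes (k ∷ ks) conf a (k≢c All.∷ ks≢c) c≢j conf≢ν = begin
    s * run ν j ks (upd conf k a) (conf k) + (1# - s) * run ν j ks conf a
      ≈⟨ +-cong (*-congˡ (run-vanishes ks _ _ ks≢c c≢j (conf≢ν ∘ ≡.trans (≡.sym (upd-other conf k a (k≢c ∘ ≡.sym))))))
                (*-congˡ (run-vanishes ks conf a ks≢c c≢j conf≢ν)) ⟩
    s * 0# + (1# - s) * 0#
      ≈⟨ +-cong (zeroʳ s) (zeroʳ _) ⟩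
    0# + 0#
      ≈⟨ +-identityʳ 0# ⟩
    0# ∎
    where s = if a ≤ᵇ conf k then 𝔭 k else 𝔮 k

  -- The state of a run that can still end in ν once the active particle, of
  -- label a, has passed the first c₀ sites.  Every label picked up so far
  -- (together with the initial vacancy 0) has been put down on a visited site,
  -- except the active one.
  record Invariant (c₀ : ℕ) (conf : Fin n → ℕ) (a : ℕ) : Set where
    field
      visited         : ∀ k → toℕ k ℕ.< c₀ → conf k ≡ ν k
      unvisited       : ∀ k → c₀ ℕ.≤ toℕ k → conf k ≡ ρ k
      picked-up       : ∀ i → toℕ i ℕ.< c₀ → toℕ (dest i) ℕ.< c₀ ⊎ ρ i ≡ a
      put-down        : ∀ k → toℕ k ℕ.< c₀ → ν k ≡ 0 ⊎ toℕ (origin k) ℕ.< c₀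
      active-origin   : a ≡ 0 ⊎ ∃[ i ] toℕ i ℕ.< c₀ × ρ i ≡ a
      active-unplaced : ∀ k → toℕ k ℕ.< c₀ → ν k ≢ a
      vacancy-placed  : a ≢ 0 → ∃[ k ] toℕ k ℕ.< c₀ × ν k ≡ 0

    crossing⇒active : ∀ {k} → toℕ k ≡ c₀ → ∀ i → between i (dest i) k ≡ true → ρ i ≡ a
    crossing⇒active k≡c₀ i crosses with picked-up i (≡.subst (toℕ i ℕ.<_) k≡c₀ (<ᶠ-true⁻ (proj₁ (∧-true⁻ crosses))))
    ... | inj₁ d<c₀ = ⊥-elim (ℕₚ.<-asym d<c₀ (≡.subst (ℕ._< toℕ (dest i)) k≡c₀ (<ᶠ-true⁻ (proj₂ (∧-true⁻ crosses)))))
    ... | inj₂ ρi≡a = ρi≡a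

  initial : Invariant 0 ρ 0
  initial = record
    { visited         = λ _ ()
    ; unvisited       = λ _ _ → refl
    ; picked-up       = λ _ ()
    ; put-down        = λ _ ()
    ; active-origin   = inj₁ refl
    ; active-unplaced = λ _ ()
    ; vacancy-placed  = λ a≢0 → ⊥-elim (a≢0 refl)
    }

  ρ≡0⇒j : ∀ {i} → ρ i ≡ 0 → i ≡ j
  ρ≡0⇒j ρi≡0 = ρ-injective (≡.trans ρi≡0 (≡.sym ρj≡0))

  module AtSite {c₀} {k : Fin n} (k≡c₀ : toℕ k ≡ c₀) (k<j : k < j) {conf a} (I : Invariant c₀ conf a) where
    open Invariant I

    k≢j : k ≢ j
    k≢j k≡j = ℕₚ.<-irrefl (≡.cong toℕ k≡j) k<j

    ρk≢0 : ρ k ≢ 0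
    ρk≢0 = k≢j ∘ ρ≡0⇒j

    conf-k : conf k ≡ ρ k
    conf-k = unvisited k (ℕₚ.≤-reflexive (≡.sym k≡c₀))

    visited⇒≢k : ∀ {k′} → toℕ k′ ℕ.< c₀ → k′ ≢ k
    visited⇒≢k k′<c₀ k′≡k = ℕₚ.<-irrefl (≡.trans (≡.cong toℕ k′≡k) k≡c₀) k′<c₀

    beyond⇒≢k : ∀ {k′} → c₀ ℕ.< toℕ k′ → k′ ≢ k
    beyond⇒≢k c₀<k′ k′≡k = ℕₚ.<-irrefl (≡.sym (≡.trans (≡.cong toℕ k′≡k) k≡c₀)) c₀<k′

    a≢ρk : a ≢ ρ k
    a≢ρk with active-origin
    ... | inj₁ a≡0             = λ a≡ρk → ρk≢0 (≡.trans (≡.sym a≡ρk) a≡0)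
    ... | inj₂ (i , i<c₀ , ρi≡a) = λ a≡ρk → visited⇒≢k i<c₀ (ρ-injective (≡.trans ρi≡a a≡ρk))

    k<1+c₀ : toℕ k ℕ.< suc c₀
    k<1+c₀ = ℕₚ.≤-reflexive (≡.cong suc k≡c₀)

    visited-or-k : ∀ {k′} → toℕ k′ ℕ.< suc c₀ → toℕ k′ ℕ.< c₀ ⊎ k′ ≡ k
    visited-or-k k′<1+c₀ = Sum.map₂ (λ k′≡c₀ → Finₚ.toℕ-injective (≡.trans k′≡c₀ (≡.sym k≡c₀))) (ℕₚ.m<1+n⇒m<n∨m≡n k′<1+c₀)

    unplaced⇒≥c₀ : ∀ {k′} → ν k′ ≡ a → c₀ ℕ.≤ toℕ k′
    unplaced⇒≥c₀ νk′≡a = ℕₚ.≮⇒≥ (λ k′<c₀ → active-unplaced _ k′<c₀ νk′≡a)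

    s : Carrier
    s = if a ≤ᵇ conf k then 𝔭 k else 𝔮 k

    s≡ : ∀ {b} → a ≤ᵇ ρ k ≡ b → s ≡ (if b then 𝔭 k else 𝔮 k)
    s≡ e = Boolₚ.if-cong (≡.trans (≡.cong (a ≤ᵇ_) conf-k) e)

    module Skip (νk≡ρk : ν k ≡ ρ k) where

      dest-k : dest k ≡ k
      dest-k = ≡.sym (dest-unique νk≡ρk)

      invariant : Invariant (suc c₀) conf a
      invariant = record
        { visited         = λ k′ lt → [ visited k′ , (λ { refl → ≡.trans conf-k (≡.sym νk≡ρk) }) ]′ (visited-or-k lt)
        ; unvisited       = λ k′ lt → unvisited k′ (ℕₚ.<⇒≤ lt)
        ; picked-up       = λ i lt → [ Sum.map₁ ℕₚ.m<n⇒m<1+n ∘ picked-up i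
                                     , (λ { refl → inj₁ (≡.subst (λ d → toℕ d ℕ.< suc c₀) (≡.sym dest-k) k<1+c₀) }) ]′
                                     (visited-or-k lt)
        ; put-down        = λ k′ lt → [ Sum.map₂ ℕₚ.m<n⇒m<1+n ∘ put-down k′
                                      , (λ { refl → inj₂ (≡.subst (λ o → toℕ o ℕ.< suc c₀)
                                                                  (origin-unique (≡.sym νk≡ρk)) k<1+c₀) }) ]′
                                      (visited-or-k lt)
        ; active-origin   = Sum.map₂ (λ (i , lt , ρi≡a) → i , ℕₚ.m<n⇒m<1+n lt , ρi≡a) active-origin
        ; active-unplaced = λ k′ lt → [ active-unplaced k′ , (λ { refl νk≡a → a≢ρk (≡.trans (≡.sym νk≡a) νk≡ρk) }) ]′
                                      (visited-or-k lt)
        ; vacancy-placed  = λ a≢0 → Data.Product.map₂ (Data.Product.map₁ ℕₚ.m<n⇒m<1+n) (vacancy-placed a≢0)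
        }

      crossingWt-k : crossingWt k ≈ (if ρ k ℕ.<ᵇ a then t else 1#)
      crossingWt-k with active-origin
      ... | inj₁ refl = crossingWt-trivial (λ i crosses → ⊥-elim (ℕₚ.<-asym k<j (≡.subst (λ i → i < k)
              (ρ≡0⇒j (crossing⇒active k≡c₀ i crosses)) (<ᶠ-true⁻ (proj₁ (∧-true⁻ crosses))))))
      ... | inj₂ (i₀ , i₀<c₀ , ρi₀≡a) = begin
        Πᴸ (allFin n) (λ i → skipWt i (dest i) k)  ≈⟨ Πᴸ-single n i₀ _ (λ i i≢i₀ → skipWt-trivial (only-i₀ i i≢i₀)) ⟩
        skipWt i₀ (dest i₀) k                       ≡⟨ ≡.cong (λ b → if b ∧ (ν k ℕ.<ᵇ ρ i₀) then t else 1#) crosses ⟩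
        (if ν k ℕ.<ᵇ ρ i₀ then t else 1#)           ≡⟨ ≡.cong₂ (λ u v → if u ℕ.<ᵇ v then t else 1#) νk≡ρk ρi₀≡a ⟩
        (if ρ k ℕ.<ᵇ a then t else 1#)              ∎
        where
        only-i₀ : ∀ i → i ≢ i₀ → between i (dest i) k ∧ (ν k ℕ.<ᵇ ρ i) ≡ false
        only-i₀ i i≢i₀ with between i (dest i) k in crosses
        ... | true  = ⊥-elim (i≢i₀ (ρ-injective (≡.trans (crossing⇒active k≡c₀ i crosses) (≡.sym ρi₀≡a))))
        ... | false = refl
        c₀≤dest : c₀ ℕ.≤ toℕ (dest i₀)
        c₀≤dest = unplaced⇒≥c₀ (≡.trans (ν∘dest i₀) ρi₀≡a)
        dest≢k : dest i₀ ≢ k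
        dest≢k d≡k = a≢ρk (≡.trans (≡.sym (≡.trans (ν∘dest i₀) ρi₀≡a)) (≡.trans (≡.cong ν d≡k) νk≡ρk))
        crosses : between i₀ (dest i₀) k ≡ true
        crosses = ≡.cong₂ _∧_ (<ᶠ-true (≡.subst (toℕ i₀ ℕ.<_) (≡.sym k≡c₀) i₀<c₀))
                              (<ᶠ-true (ℕₚ.≤∧≢⇒< (≡.subst (ℕ._≤ toℕ (dest i₀)) (≡.sym k≡c₀) c₀≤dest)
                                                  (dest≢k ∘ ≡.sym ∘ Finₚ.toℕ-injective)))

      weight : ¬ t ≈ 0# → ¬ x k ≈ t₂ → (1# - s) * denomFactor k ≈ siteWt k
      weight t≉0 xk≉t₂ with a ℕ.≤? ρ k
      ... | yes a≤ρk = begin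
        (1# - s) * denomFactor k   ≡⟨ ≡.cong₂ (λ u d → (1# - u) * d) (s≡ (≤ᵇ-true a≤ρk)) (denomFactor-before k<j) ⟩
        (1# - 𝔭 k) * (x k - t₂)    ≈⟨ [1-𝔭]*[x-t₂] xk≉t₂ t≉0 ⟩
        x k - t₁                   ≈⟨ *-identityʳ _ ⟨
        (x k - t₁) * 1#            ≈⟨ *-cong (reflexive (≡.sym (columnFactor-fixed ρk≢0 dest-k)))
                                             (sym (trans crossingWt-k (reflexive (Boolₚ.if-cong (<ᵇ-false (ℕₚ.≤⇒≯ a≤ρk)))))) ⟩
        siteWt k                   ∎
      ... | no a≰ρk = begin
        (1# - s) * denomFactor k   ≡⟨ ≡.cong₂ (λ u d → (1# - u) * d) (s≡ (≤ᵇ-false a≰ρk)) (denomFactor-before k<j) ⟩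
        (1# - 𝔮 k) * (x k - t₂)    ≈⟨ [1-𝔮]*[x-t₂] xk≉t₂ t≉0 ⟩
        (x k - t₁) * t             ≈⟨ *-cong (reflexive (≡.sym (columnFactor-fixed ρk≢0 dest-k)))
                                             (sym (trans crossingWt-k (reflexive (Boolₚ.if-cong (<ᵇ-true (ℕₚ.≰⇒> a≰ρk)))))) ⟩
        siteWt k                   ∎

    module Settle (νk≡a : ν k ≡ a) where

      νk≢ρk : ν k ≢ ρ k
      νk≢ρk = a≢ρk ∘ ≡.trans (≡.sym νk≡a)

      k<dest : k < dest k
      k<dest = ℕₚ.≤∧≢⇒< (≡.subst (ℕ._≤ toℕ (dest k)) (≡.sym k≡c₀) c₀≤dest) (dest≢k ∘ ≡.sym ∘ Finₚ.toℕ-injective)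
        where
        dest≢k : dest k ≢ k
        dest≢k d≡k = νk≢ρk (≡.trans (≡.cong ν (≡.sym d≡k)) (ν∘dest k))
        c₀≤dest : c₀ ℕ.≤ toℕ (dest k)
        c₀≤dest = ℕₚ.≮⇒≥ λ d<c₀ →
          [ (λ νd≡0 → ρk≢0 (≡.trans (≡.sym (ν∘dest k)) νd≡0))
          , (λ o<c₀ → visited⇒≢k o<c₀ (≡.sym (origin-unique (≡.sym (ν∘dest k))))) ]′ (put-down (dest k) d<c₀)

      invariant : Invariant (suc c₀) (upd conf k a) (ρ k)
      invariant = record
        { visited         = λ k′ lt → [ (λ k′<c₀ → ≡.trans (upd-other conf k a (visited⇒≢k k′<c₀)) (visited k′ k′<c₀))
                                      , (λ { refl → ≡.trans (upd-same conf k a) (≡.sym νk≡a) }) ]′ (visited-or-k lt)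
        ; unvisited       = λ k′ lt → ≡.trans (upd-other conf k a (beyond⇒≢k lt))
                                              (unvisited k′ (ℕₚ.<⇒≤ lt))
        ; picked-up       = λ i lt → [ picked-up-visited i , (λ { refl → inj₂ refl }) ]′ (visited-or-k lt)
        ; put-down        = λ k′ lt → [ Sum.map₂ ℕₚ.m<n⇒m<1+n ∘ put-down k′ , (λ { refl → put-down-k }) ]′ (visited-or-k lt)
        ; active-origin   = inj₂ (k , k<1+c₀ , refl)
        ; active-unplaced = λ k′ lt → [ unplaced-visited k′ , (λ { refl → νk≢ρk }) ]′ (visited-or-k lt)
        ; vacancy-placed  = λ _ → vacancy-placed′
        }
        where
        picked-up-visited : ∀ i → toℕ i ℕ.< c₀ → toℕ (dest i) ℕ.< suc c₀ ⊎ ρ i ≡ ρ k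
        picked-up-visited i i<c₀ with picked-up i i<c₀
        ... | inj₁ d<c₀ = inj₁ (ℕₚ.m<n⇒m<1+n d<c₀)
        ... | inj₂ ρi≡a = inj₁ (≡.subst (λ d → toℕ d ℕ.< suc c₀) (dest-unique (≡.trans νk≡a (≡.sym ρi≡a))) k<1+c₀)
        put-down-k : ν k ≡ 0 ⊎ toℕ (origin k) ℕ.< suc c₀
        put-down-k with active-origin
        ... | inj₁ a≡0                 = inj₁ (≡.trans νk≡a a≡0)
        ... | inj₂ (i₀ , i₀<c₀ , ρi₀≡a) = inj₂ (≡.subst (λ o → toℕ o ℕ.< suc c₀)
                                                 (origin-unique (≡.trans ρi₀≡a (≡.sym νk≡a))) (ℕₚ.m<n⇒m<1+n i₀<c₀))
        unplaced-visited : ∀ k′ → toℕ k′ ℕ.< c₀ → ν k′ ≢ ρ k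
        unplaced-visited k′ k′<c₀ νk′≡ρk with put-down k′ k′<c₀
        ... | inj₁ νk′≡0 = ρk≢0 (≡.trans (≡.sym νk′≡ρk) νk′≡0)
        ... | inj₂ o<c₀  = visited⇒≢k o<c₀ (≡.sym (origin-unique (≡.sym νk′≡ρk)))
        vacancy-placed′ : ∃[ k′ ] toℕ k′ ℕ.< suc c₀ × ν k′ ≡ 0
        vacancy-placed′ with a ℕ.≟ 0
        ... | yes a≡0 = k , k<1+c₀ , ≡.trans νk≡a a≡0
        ... | no  a≢0 = Data.Product.map₂ (Data.Product.map₁ ℕₚ.m<n⇒m<1+n) (vacancy-placed a≢0)

      crossingWt-k : crossingWt k ≈ 1#
      crossingWt-k = crossingWt-trivial λ i crosses →
        ≡.trans (≡.cong₂ ℕ._<ᵇ_ νk≡a (crossing⇒active k≡c₀ i crosses)) (<ᵇ-false (ℕₚ.<-irrefl {a} refl))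

      columnFactor-k : ∀ {b} → a ≤ᵇ ρ k ≡ b → columnFactor k ≡ (if b then t₁ else x k) * (1# - t)
      columnFactor-k e = ≡.trans (columnFactor-forward ρk≢0 k<dest)
                                 (≡.cong (λ b → (if b then t₁ else x k) * (1# - t)) (≡.trans (≡.cong (_≤ᵇ ρ k) νk≡a) e))

      weight : ¬ x k ≈ t₂ → s * denomFactor k ≈ siteWt k
      weight xk≉t₂ with a ℕ.≤? ρ k
      ... | yes a≤ρk = begin
        s * denomFactor k        ≡⟨ ≡.cong₂ _*_ (s≡ (≤ᵇ-true a≤ρk)) (denomFactor-before k<j) ⟩
        𝔭 k * (x k - t₂)         ≈⟨ 𝔭*[x-t₂] xk≉t₂ ⟩
        t₁ * (1# - t)            ≈⟨ *-identityʳ _ ⟨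
        (t₁ * (1# - t)) * 1#     ≈⟨ *-cong (reflexive (≡.sym (columnFactor-k (≤ᵇ-true a≤ρk)))) (sym crossingWt-k) ⟩
        siteWt k                 ∎
      ... | no a≰ρk = begin
        s * denomFactor k        ≡⟨ ≡.cong₂ _*_ (s≡ (≤ᵇ-false a≰ρk)) (denomFactor-before k<j) ⟩
        𝔮 k * (x k - t₂)         ≈⟨ 𝔮*[x-t₂] xk≉t₂ ⟩
        x k * (1# - t)           ≈⟨ *-identityʳ _ ⟨
        (x k * (1# - t)) * 1#    ≈⟨ *-cong (reflexive (≡.sym (columnFactor-k (≤ᵇ-false a≰ρk)))) (sym crossingWt-k) ⟩
        siteWt k                 ∎

    stuck : ν k ≢ ρ k → ν k ≢ a → Πfrom c₀ siteWt ≈ 0#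
    stuck νk≢ρk νk≢a = Πfrom-zero (origin k) (ℕₚ.<⇒≤ c₀<o) (siteWt-backward ρo≢0 d<o)
      where
      νk≢0 : ν k ≢ 0
      νk≢0 νk≡0 with k″ , k″<c₀ , νk″≡0 ← vacancy-placed (λ a≡0 → νk≢a (≡.trans νk≡0 (≡.sym a≡0)))
        = visited⇒≢k k″<c₀ (ν-injective (≡.trans νk″≡0 (≡.sym νk≡0)))
      ρo≢0 : ρ (origin k) ≢ 0
      ρo≢0 = νk≢0 ∘ ≡.trans (≡.sym (ρ∘origin k))
      c₀<o : c₀ ℕ.< toℕ (origin k)
      c₀<o = ℕₚ.≤∧≢⇒< (ℕₚ.≮⇒≥ unvisited-origin)
        (λ c₀≡o → νk≢ρk (≡.trans (≡.sym (ρ∘origin k)) (≡.cong ρ (Finₚ.toℕ-injective (≡.trans (≡.sym c₀≡o) (≡.sym k≡c₀))))))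
        where
        unvisited-origin : ¬ toℕ (origin k) ℕ.< c₀
        unvisited-origin o<c₀ =
          [ ℕₚ.<-irrefl (≡.trans (≡.cong toℕ (dest∘origin k)) k≡c₀) , (λ ρo≡a → νk≢a (≡.trans (≡.sym (ρ∘origin k)) ρo≡a)) ]′
          (picked-up (origin k) o<c₀)
      d<o : dest (origin k) < origin k
      d<o = ≡.subst (ℕ._< toℕ (origin k)) (≡.sym (≡.trans (≡.cong toℕ (dest∘origin k)) k≡c₀)) c₀<o

  module AtEnd {conf a} (I : Invariant (toℕ j) conf a) where
    open Invariant I

    final : Fin n → ℕ
    final = upd conf j a

    final-above : ∀ {i} → j < i → final i ≡ ρ i
    final-above j<i = ≡.trans (upd-other conf j a (λ i≡j → ℕₚ.<-irrefl (≡.cong toℕ (≡.sym i≡j)) j<i))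
                              (unvisited _ (ℕₚ.<⇒≤ j<i))

    agree : (∀ i → final i ≡ ν i) → Πfrom (toℕ j) denomFactor ≈ Πfrom (toℕ j) siteWt
    agree matches = Πfrom-cong (toℕ j) λ k j≤k →
      [ after , (λ j≡k → ≡.subst (λ k → denomFactor k ≈ siteWt k) (Finₚ.toℕ-injective j≡k) at-j) ]′
      (ℕₚ.m≤n⇒m<n∨m≡n j≤k)
      where
      νj≡a : ν j ≡ a
      νj≡a = ≡.trans (≡.sym (matches j)) (upd-same conf j a)
      ν≡ρ-above : ∀ {i} → j < i → ν i ≡ ρ i
      ν≡ρ-above j<i = ≡.trans (≡.sym (matches _)) (final-above j<i)
      at-j : denomFactor j ≈ siteWt j
      at-j = begin
        denomFactor j  ≡⟨ denomFactor-j ⟩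
        1#             ≈⟨ *-identityʳ 1# ⟨
        1# * 1#        ≈⟨ *-cong (reflexive (≡.sym (columnFactor-vacancy ρj≡0))) (sym (crossingWt-trivial λ i crosses →
                            ≡.trans (≡.cong₂ ℕ._<ᵇ_ νj≡a (crossing⇒active refl i crosses)) (<ᵇ-false (ℕₚ.<-irrefl {a} refl)))) ⟩
        siteWt j       ∎
      after : ∀ {k} → j < k → denomFactor k ≈ siteWt k
      after {k} j<k = begin
        denomFactor k    ≡⟨ denomFactor-after j<k ⟩
        x k - t₁         ≈⟨ *-identityʳ _ ⟨
        (x k - t₁) * 1#  ≈⟨ *-cong (reflexive (≡.sym (columnFactor-fixed ρk≢0 (≡.sym (dest-unique (ν≡ρ-above j<k))))))
                                   (sym (crossingWt-trivial no-crossing)) ⟩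
        siteWt k         ∎
        where
        ρk≢0 : ρ k ≢ 0
        ρk≢0 ρk≡0 = ℕₚ.<-irrefl (≡.cong toℕ (≡.sym (ρ≡0⇒j ρk≡0))) j<k
        no-crossing : ∀ i → between i (dest i) k ≡ true → (ν k ℕ.<ᵇ ρ i) ≡ false
        no-crossing i crosses with ℕₚ.<-cmp (toℕ i) (toℕ j)
        ... | tri< i<j _ _ = ⊥-elim ([ (λ d<j → ℕₚ.<-asym d<j (ℕₚ.<-trans j<k k<d))
                                     , (λ ρi≡a → ℕₚ.<-asym j<k (≡.subst (λ d → k < d)
                                                   (≡.sym (dest-unique (≡.trans νj≡a (≡.sym ρi≡a)))) k<d)) ]′
                                     (picked-up i i<j))
          where k<d = <ᶠ-true⁻ (proj₂ (∧-true⁻ crosses))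
        ... | tri≈ _ i≡j _ = ≡.cong (ν k ℕ.<ᵇ_) (≡.trans (≡.cong ρ (Finₚ.toℕ-injective i≡j)) ρj≡0)
        ... | tri> _ _ j<i = ⊥-elim (ℕₚ.<-asym (<ᶠ-true⁻ (proj₁ (∧-true⁻ crosses)))
                                      (≡.subst (λ d → k < d) (≡.sym (dest-unique (ν≡ρ-above j<i)))
                                               (<ᶠ-true⁻ (proj₂ (∧-true⁻ crosses)))))

    module FirstMismatch {k} (j≤k : toℕ j ℕ.≤ toℕ k) (agree-below : ∀ i → i < k → final i ≡ ν i)
                         (mismatch : final k ≢ ν k) where

      νk≢a : ν k ≢ a
      νk≢a νk≡a with ℕₚ.m≤n⇒m<n∨m≡n j≤k
      ... | inj₁ j<k = ℕₚ.<-irrefl (≡.cong toℕ (ν-injective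
                         (≡.trans (≡.sym (agree-below j j<k)) (≡.trans (upd-same conf j a) (≡.sym νk≡a))))) j<k
      ... | inj₂ j≡k = mismatch (≡.trans (≡.cong final (Finₚ.toℕ-injective (≡.sym j≡k)))
                                         (≡.trans (upd-same conf j a) (≡.sym νk≡a)))

      νk≢0 : ν k ≢ 0
      νk≢0 νk≡0 with a ℕ.≟ 0
      ... | yes a≡0 = νk≢a (≡.trans νk≡0 (≡.sym a≡0))
      ... | no  a≢0 with k″ , k″<j , νk″≡0 ← vacancy-placed a≢0
        = ℕₚ.<-irrefl (≡.cong toℕ (ν-injective (≡.trans νk″≡0 (≡.sym νk≡0)))) (ℕₚ.<-≤-trans k″<j j≤k)

      k<origin : k < origin k
      k<origin with ℕₚ.<-cmp (toℕ (origin k)) (toℕ j)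
      ... | tri< o<j _ _ = ⊥-elim ([ (λ d<j → ℕₚ.<⇒≱ (≡.subst (ℕ._< toℕ j) (≡.cong toℕ (dest∘origin k)) d<j) j≤k)
                                   , (λ ρo≡a → νk≢a (≡.trans (≡.sym (ρ∘origin k)) ρo≡a)) ]′
                                   (picked-up (origin k) o<j))
      ... | tri≈ _ o≡j _ = ⊥-elim (νk≢0 (≡.trans (≡.sym (ρ∘origin k)) (≡.trans (≡.cong ρ (Finₚ.toℕ-injective o≡j)) ρj≡0)))
      ... | tri> _ _ j<o with ℕₚ.<-cmp (toℕ (origin k)) (toℕ k)
      ...   | tri< o<k _ _ = ⊥-elim (ℕₚ.<-irrefl (≡.cong toℕ (≡.trans (dest-unique
                               (≡.trans (≡.sym (agree-below _ o<k)) (final-above j<o))) (dest∘origin k))) o<k)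
      ...   | tri≈ _ o≡k _ = ⊥-elim (mismatch (≡.subst (λ i → final i ≡ ν k) (Finₚ.toℕ-injective o≡k)
                                                       (≡.trans (final-above j<o) (ρ∘origin k))))
      ...   | tri> _ _ k<o = k<o

      vanishes : Πfrom (toℕ j) siteWt ≈ 0#
      vanishes = Πfrom-zero (origin k) (ℕₚ.≤-trans j≤k (ℕₚ.<⇒≤ k<origin))
        (siteWt-backward (νk≢0 ∘ ≡.trans (≡.sym (ρ∘origin k))) (≡.subst (_< origin k) (≡.sym (dest∘origin k)) k<origin))

    disagree : ¬ (∀ i → final i ≡ ν i) → Πfrom (toℕ j) siteWt ≈ 0#
    disagree ¬agree
      with k , mismatch , agree-inject ← Finₚ.¬∀⟶∃¬-smallest n (λ i → final i ≡ ν i) (λ i → final i ℕ.≟ ν i) ¬agree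
      with toℕ k ℕ.<? toℕ j
    ... | yes k<j = ⊥-elim (mismatch (≡.trans (upd-other conf j a (λ k≡j → ℕₚ.<-irrefl (≡.cong toℕ k≡j) k<j))
                                              (visited k k<j)))
    ... | no  k≮j = FirstMismatch.vanishes (ℕₚ.≮⇒≥ k≮j) agree-below mismatch
      where
      agree-below : ∀ i → i < k → final i ≡ ν i
      agree-below i i<k = ≡.subst (λ i → final i ≡ ν i)
        (Finₚ.toℕ-injective (≡.trans (Finₚ.toℕ-inject (Fin.fromℕ< i<k)) (Finₚ.toℕ-fromℕ< i<k)))
        (agree-inject (Fin.fromℕ< i<k))

    end : run ν j [] conf a * Πfrom (toℕ j) denomFactor ≈ Πfrom (toℕ j) siteWt
    end = byAgreement (Finₚ.all? (λ i → final i ℕ.≟ ν i))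
      where
      byAgreement : (d : Dec (∀ i → final i ≡ ν i)) →
                    (if ⌊ d ⌋ then 1# else 0#) * Πfrom (toℕ j) denomFactor ≈ Πfrom (toℕ j) siteWt
      byAgreement (yes matches) = trans (*-identityˡ _) (agree matches)
      byAgreement (no  ¬agree)  = trans (zeroˡ _) (sym (disagree ¬agree))

  module _ (t≉0 : ¬ t ≈ 0#) (x≉t₂ : ∀ k → k < j → ¬ x k ≈ t₂) where

    run≈ : ∀ d {c₀} → c₀ ℕ.+ d ≡ toℕ j → ∀ {ks} → map toℕ ks ≡ interval c₀ d → ∀ {conf a} → Invariant c₀ conf a →
           run ν j ks conf a * Πfrom c₀ denomFactor ≈ Πfrom c₀ siteWt
    run≈ zero {c₀} c₀+0≡j {[]} _ I with refl ← ≡.trans (≡.sym (ℕₚ.+-identityʳ c₀)) c₀+0≡j = AtEnd.end I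
    run≈ (suc d) {c₀} c₀+d≡j {k ∷ ks} eq {conf} {a} I = begin
      run ν j (k ∷ ks) conf a * Πfrom c₀ denomFactor
        ≈⟨ *-congˡ (Πfrom-step denomFactor k≡c₀) ⟩
      (s * R₁ + (1# - s) * R₂) * (denomFactor k * Πfrom (suc c₀) denomFactor)
        ≈⟨ step (ν k ℕ.≟ ρ k) (ν k ℕ.≟ a) ⟩
      siteWt k * Πfrom (suc c₀) siteWt
        ≈⟨ Πfrom-step siteWt k≡c₀ ⟨
      Πfrom c₀ siteWt ∎
      where
      k≡c₀ : toℕ k ≡ c₀
      k≡c₀ = Listₚ.∷-injectiveˡ eq
      k<j : k < j
      k<j = ≡.subst₂ ℕ._<_ (≡.sym k≡c₀) c₀+d≡j (ℕₚ.m<m+n c₀ ℕ.z<s)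
      open AtSite k≡c₀ k<j I
      R₁ R₂ : Carrier
      R₁ = run ν j ks (upd conf k a) (conf k)
      R₂ = run ν j ks conf a
      rest-avoids-k : All (_≢ k) ks
      rest-avoids-k = interval-avoids (Listₚ.∷-injectiveʳ eq) k<1+c₀
      IH : ∀ {conf′ a′} → Invariant (suc c₀) conf′ a′ →
           run ν j ks conf′ a′ * Πfrom (suc c₀) denomFactor ≈ Πfrom (suc c₀) siteWt
      IH = run≈ d (≡.trans (≡.sym (ℕₚ.+-suc c₀ d)) c₀+d≡j) (Listₚ.∷-injectiveʳ eq)
      R₁≈0 : ν k ≢ a → R₁ ≈ 0#
      R₁≈0 νk≢a = run-vanishes ks _ _ rest-avoids-k k≢j (νk≢a ∘ ≡.sym ∘ ≡.trans (≡.sym (upd-same conf k a)))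
      R₂≈0 : ν k ≢ ρ k → R₂ ≈ 0#
      R₂≈0 νk≢ρk = run-vanishes ks conf a rest-avoids-k k≢j (νk≢ρk ∘ ≡.sym ∘ ≡.trans (≡.sym conf-k))
      step : Dec (ν k ≡ ρ k) → Dec (ν k ≡ a) →
             (s * R₁ + (1# - s) * R₂) * (denomFactor k * Πfrom (suc c₀) denomFactor) ≈ siteWt k * Πfrom (suc c₀) siteWt
      step (yes νk≡ρk) _ = trans (second-branch (R₁≈0 (λ νk≡a → a≢ρk (≡.trans (≡.sym νk≡a) νk≡ρk))))
                                 (*-cong (Skip.weight νk≡ρk t≉0 (x≉t₂ k k<j)) (IH (Skip.invariant νk≡ρk)))
      step (no νk≢ρk) (yes νk≡a) = trans (first-branch (R₂≈0 νk≢ρk))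
        (*-cong (Settle.weight νk≡a (x≉t₂ k k<j))
                (trans (*-congʳ (reflexive (≡.cong (run ν j ks (upd conf k a)) conf-k))) (IH (Settle.invariant νk≡a))))
      step (no νk≢ρk) (no νk≢a) = begin
        (s * R₁ + (1# - s) * R₂) * (denomFactor k * Πfrom (suc c₀) denomFactor)
          ≈⟨ *-congʳ (trans (+-cong (trans (*-congˡ (R₁≈0 νk≢a)) (zeroʳ s)) (trans (*-congˡ (R₂≈0 νk≢ρk)) (zeroʳ _)))
                            (+-identityʳ 0#)) ⟩
        0# * (denomFactor k * Πfrom (suc c₀) denomFactor)
          ≈⟨ zeroˡ _ ⟩
        0#
          ≈⟨ stuck νk≢ρk νk≢a ⟨
        Πfrom c₀ siteWt
          ≈⟨ Πfrom-step siteWt k≡c₀ ⟩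
        siteWt k * Πfrom (suc c₀) siteWt ∎

    -- Πfrom 0 denomFactor and Πfrom 0 siteWt compute to denom j and Πᴸ (allFin n) siteWt.
    P2*denom≈cCoef : P2 j ρ ν * denom j ≈ cCoef ρ ν
    P2*denom≈cCoef = trans (run≈ (toℕ j) refl (toℕ-sitesBefore j) initial) (sym cCoef≈ΠsiteWt)

  denom≉0 : (∀ k → k < j → ¬ x k ≈ t₂) → (∀ k → j < k → ¬ x k ≈ t₁) → ¬ denom j ≈ 0#
  denom≉0 x≉t₂ x≉t₁ = Πᴸ-nonzero (allFin n) factor≉0
    where
    factor≉0 : ∀ k → ¬ denomFactor k ≈ 0#
    factor≉0 k with Finₚ.<-cmp k j
    ... | tri< k<j _ _  = u≉v⇒u-v≉0 (x≉t₂ k k<j) ∘ trans (reflexive (≡.sym (denomFactor-before k<j)))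
    ... | tri≈ _ refl _ = 0≉1 ∘ sym ∘ trans (reflexive (≡.sym denomFactor-j))
    ... | tri> _ _ j<k  = u≉v⇒u-v≉0 (x≉t₁ k j<k) ∘ trans (reflexive (≡.sym (denomFactor-after j<k)))

proposition5p4 : ∀ {c ℓ} (F : Field c ℓ) → let open WithField F in
    (n : ℕ) (lam ρ ν : Fin n → ℕ) →
    IsRestrictedPartition n lam → InS n lam ρ → InS n lam ν →
    (j : Fin n) → ρ j ≡ 0 →
    (x : Fin n → Carrier) (t : Carrier) → ¬ (t ≈ 0#) →
    (∀ k → k < j → ¬ (x k ≈ Params.t₂ n x t)) →
    (∀ k → j < k → ¬ (x k ≈ Params.t₁ n x t)) →
    Params.P2 n x t j ρ ν ≈ Params.cCoef n x t ρ ν * (Params.denom n x t j ⁻¹)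
proposition5p4 F n lam ρ ν (_ , lam-injective , _ , _) hρ hν j ρj≡0 x t t≉0 x≉t₂ x≉t₁ =
  u*d≈v⇒u≈v*d⁻¹ (denom≉0 x≉t₂ x≉t₁) (P2*denom≈cCoef t≉0 x≉t₂)
  where
  open FieldFacts F
  open Run F n x t (distinctRearrangement lam-injective hρ hν) j ρj≡0
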